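{- Let $\mathcal{A}=\{H_1,\dots,H_n\}$ be a central hyperplane arrangement in $\mathbb{R}^\ell$ and $\mathcal{K}=\bigcap_{i\in W}H_i^+$ a cone, $W\subseteq[n]$, and let $\prec$ be a monomial order on $\mathbb{Z}[e_1,\dots,e_n]$ with $e_1\prec e_2\prec\cdots\prec e_n$. Then every $\mathrm{in}_\prec(\mathcal{G})$-standard monomial is a $\mathcal{K}$-NBC monomial, i.e. is of the form $e_N=\prod_{i\in N}e_i$ with $N\in NBC(\mathcal{K})$.
   Context: $H_i=\{\mathbf{x}: v_i\cdot\mathbf{x}=0\}$ distinct hyperplanes with fixed normals $v_i$, $H_i^+=\{v_i\cdot\mathbf{x}>0\}$; $\mathcal{K}$ is assumed to be a (nonempty) cone. A signed dependency is a pair $(D^+,D^-)$ of disjoint subsets of $[n]$ with $D^+=\{i:\lambda_i>0\}$, $D^-=\{i:\lambda_i<0\}$ for a linear relation $\sum\lambda_iv_i=0$; $\underline{D}=D^+\cup D^-$; a signed circuit is a nonzero signed dependency with $\underline{C}$ inclusion-minimal. A broken circuit is $\underline{C}\setminus\{\min\underline{C}\}$ for a signed circuit $C$; $N\subseteq[n]$ is a $\mathcal{K}$-NBC set ($N\in NBC(\mathcal{K})$) if it contains no broken circuit and $\bigcap_{i\in N}H_i\cap\mathcal{K}\ne\emptyset$. $e_S=\prod_{i\in S}e_i$. $\mathcal{G}$ consists of: $e_i^2-e_i$ for $i\in[n]$; $e_i-1$ for $i\in W$; for each signed circuit $C$ with $\emptyset\ne W\cap C^+=W\cap\underline{C}$,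 $e_{C^+\setminus W}\prod_{j\in C^- }(e_j-1)$, and for each with $\emptyset\ne W\cap C^-=W\cap\underline{C}$, $e_{C^-\setminus W}\prod_{j\in C^+}(e_j-1)$; for each signed circuit with $W\cap\underline{C}=\emptyset$, $e_{C^+}\prod_{j\in C^- }(e_j-1)-e_{C^- }\prod_{j\in C^+}(e_j-1)$. $\mathrm{in}_\prec(f)$ is the $\prec$-largest monomial of $f$; a monomial is $\mathrm{in}_\prec(\mathcal{G})$-standard if it is divisible by no $\mathrm{in}_\prec(g)$, $g\in\mathcal{G}$. -}

module Defs where

open import Data.Bool using (Bool; true; false; if_then_else_)
open import Data.Nat as ℕ using (ℕ; zero; suc)
open import Data.Integer as ℤ using (ℤ)
open import Data.Fin using (Fin; zero; suc; _≟_) renaming (_≤_ to _≤ꟳ_)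
open import Data.Fin.Subset using (Subset; ⊥; _∈_; _∉_; _⊆_; _∩_; _∪_; _─_; _-_; Nonempty)
open import Data.Vec as Vec using (Vec; lookup; zipWith; replicate; tabulate)
open import Data.Vec.Properties using (≡-dec)
open import Data.Vec.Relation.Binary.Pointwise.Inductive using (Pointwise)
open import Data.List as List using (List; []; _∷_; _++_; concatMap; map; foldr)
open import Data.Product using (Σ; ∃; _×_; _,_; proj₁; proj₂)
open import Data.Sum using (_⊎_)
open import Relation.Nullary using (¬_; yes; no; does)
open import Data.Fin.Subset.Properties using (_∈?_)
open import Relation.Binary.PropositionalEquality using (_≡_; _≢_)
open import Relation.Binary.Structures using (IsStrictTotalOrder)
open import Algebra.Structures using (IsCommutativeRing)

-- The real numbers, axiomatised as a complete ordered field
-- (these axioms determine ℝ up to unique isomorphism).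

record RealField : Set₁ where
  infixl 7 _*_
  infixl 6 _+_
  infix  4 _<_ _≤ᵣ_
  field
    Carrier : Set
    _+_ _*_ : Carrier → Carrier → Carrier
    -_      : Carrier → Carrier
    0# 1#   : Carrier
    _<_     : Carrier → Carrier → Set
    isCommutativeRing : IsCommutativeRing _≡_ _+_ _*_ -_ 0# 1#
    0≢1     : 0# ≢ 1#
    inverse : ∀ x → x ≢ 0# → ∃ λ y → x * y ≡ 1#
    isStrictTotalOrder : IsStrictTotalOrder _≡_ _<_
    +-mono-< : ∀ {x y} z → x < y → x + z < y + z
    *-pos    : ∀ {x y} → 0# < x → 0# < y → 0# < x * y

  _≤ᵣ_ : Carrier → Carrier → Set
  x ≤ᵣ y = x < y ⊎ x ≡ y

  field
    complete : (P : Carrier → Set) → (∃ λ x → P x) →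
               (∃ λ b → ∀ x → P x → x ≤ᵣ b) →
               ∃ λ s → (∀ x → P x → x ≤ᵣ s) ×
                       (∀ b → (∀ x → P x → x ≤ᵣ b) → s ≤ᵣ b)

module _ (ℝ : RealField) where
  open RealField ℝ

  Point : ℕ → Set
  Point ℓ = Fin ℓ → Carrier

  ∑ : ∀ {k} → (Fin k → Carrier) → Carrier
  ∑ {zero}  f = 0#
  ∑ {suc k} f = f zero + ∑ (λ i → f (suc i))

  _·_ : ∀ {ℓ} → Point ℓ → Point ℓ → Carrier
  u · x = ∑ (λ t → u t * x t)

  -- A vector of n normals v₁,…,vₙ in ℝ^ℓ defines the central arrangement
  -- H_i = {x : v_i · x = 0}.
  IsArrangement : ∀ {ℓ n} → (Fin n → Point ℓ) → Set
  IsArrangement {ℓ} {n} v =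
    (∀ i → ¬ (∀ t → v i t ≡ 0#)) ×
    (∀ i j → i ≢ j →
       ¬ (∀ (x : Point ℓ) → (v i · x ≡ 0# → v j · x ≡ 0#) × (v j · x ≡ 0# → v i · x ≡ 0#)))

  InCone : ∀ {ℓ n} → (Fin n → Point ℓ) → Subset n → Point ℓ → Set
  InCone v W x = ∀ i → i ∈ W → 0# < v i · x

  SignedDependency : ∀ {ℓ n} → (Fin n → Point ℓ) → Subset n → Subset n → Set
  SignedDependency {ℓ} {n} v D⁺ D⁻ =
    ∃ λ (λ' : Fin n → Carrier) →
      (∀ t → ∑ (λ i → λ' i * v i t) ≡ 0#) ×
      (∀ i → i ∈ D⁺ → 0# < λ' i) × (∀ i → 0# < λ' i → i ∈ D⁺) ×
      (∀ i → i ∈ D⁻ → λ' i < 0#) × (∀ i → λ' i < 0# → i ∈ D⁻)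

  SignedCircuit : ∀ {ℓ n} → (Fin n → Point ℓ) → Subset n → Subset n → Set
  SignedCircuit v C⁺ C⁻ =
    SignedDependency v C⁺ C⁻ × Nonempty (C⁺ ∪ C⁻) ×
    (∀ D⁺ D⁻ → SignedDependency v D⁺ D⁻ → Nonempty (D⁺ ∪ D⁻) →
       (D⁺ ∪ D⁻) ⊆ (C⁺ ∪ C⁻) → (C⁺ ∪ C⁻) ⊆ (D⁺ ∪ D⁻))

  BrokenCircuit : ∀ {ℓ n} → (Fin n → Point ℓ) → Subset n → Set
  BrokenCircuit {ℓ} {n} v B =
    ∃ λ (C⁺ : Subset n) → ∃ λ (C⁻ : Subset n) → ∃ λ (m : Fin n) →
      SignedCircuit v C⁺ C⁻ × m ∈ (C⁺ ∪ C⁻) ×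
      (∀ j → j ∈ (C⁺ ∪ C⁻) → m ≤ꟳ j) × B ≡ (C⁺ ∪ C⁻) - m

  IsKNBC : ∀ {ℓ n} → (Fin n → Point ℓ) → Subset n → Subset n → Set
  IsKNBC {ℓ} v W N =
    (∀ B → BrokenCircuit v B → ¬ (B ⊆ N)) ×
    ∃ λ (x : Point ℓ) → (∀ i → i ∈ N → v i · x ≡ 0#) × InCone v W x

Mono : ℕ → Set
Mono n = Vec ℕ n

oneM : ∀ {n} → Mono n
oneM = replicate _ 0

_*M_ : ∀ {n} → Mono n → Mono n → Mono n
_*M_ = zipWith ℕ._+_

_∣M_ : ∀ {n} → Mono n → Mono n → Set
a ∣M b = Pointwise ℕ._≤_ a b

varM : ∀ {n} → Fin n → Mono n
varM i = tabulate (λ j → if does (i ≟ j) then 1 else 0)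

setM : ∀ {n} → Subset n → Mono n
setM S = Vec.map (λ b → if b then 1 else 0) S

-- polynomials with integer coefficients, as formal sums of terms
Poly : ℕ → Set
Poly n = List (ℤ × Mono n)

coeff : ∀ {n} → Poly n → Mono n → ℤ
coeff []            m = ℤ.0ℤ
coeff ((c , a) ∷ p) m = (if does (≡-dec ℕ._≟_ a m) then c else ℤ.0ℤ) ℤ.+ coeff p m

monoP : ∀ {n} → Mono n → Poly n
monoP a = (ℤ.1ℤ , a) ∷ []

oneP : ∀ {n} → Poly n
oneP = monoP oneM

varP : ∀ {n} → Fin n → Poly n
varP i = monoP (varM i)

setP : ∀ {n} → Subset n → Poly n
setP S = monoP (setM S)

infixl 6 _+P_ _-P_
infixl 7 _*P_
_+P_ : ∀ {n} → Poly n → Poly n → Poly n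
_+P_ = _++_

-P_ : ∀ {n} → Poly n → Poly n
-P_ = map (λ { (c , a) → (ℤ.- c , a) })

_-P_ : ∀ {n} → Poly n → Poly n → Poly n
p -P q = p +P (-P q)

_*P_ : ∀ {n} → Poly n → Poly n → Poly n
p *P q = concatMap (λ { (c , a) → map (λ { (d , b) → (c ℤ.* d , a *M b) }) q }) p

∏P : ∀ {n k} → (Fin k → Poly n) → Poly n
∏P {k = zero}  f = oneP
∏P {k = suc k} f = f zero *P ∏P (λ i → f (suc i))

prodMinusOne : ∀ {n} → Subset n → Poly n
prodMinusOne T = ∏P (λ j → if does (j ∈? T) then varP j -P oneP else oneP)

-- Monomial orders: strict total orders on monomials compatible with
-- multiplication and with 1 as least element (⇔ well-ordered, Dickson).

record MonomialOrder (n : ℕ) : Set₁ where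
  field
    _≺_ : Mono n → Mono n → Set
    isStrictTotalOrder : IsStrictTotalOrder _≡_ _≺_
    mult : ∀ a b c → a ≺ b → (a *M c) ≺ (b *M c)
    one-least : ∀ a → a ≢ oneM → oneM ≺ a

IsInitial : ∀ {n} → MonomialOrder n → Poly n → Mono n → Set
IsInitial ord f m =
  coeff f m ≢ ℤ.0ℤ × (∀ a → coeff f a ≢ ℤ.0ℤ → a ≡ m ⊎ a ≺ m)
  where open MonomialOrder ord

module _ (ℝ : RealField) where

  data InG {ℓ n} (v : Fin n → Point ℝ ℓ) (W : Subset n) : Poly n → Set where
    idem  : ∀ i → InG v W ((varP i *P varP i) -P varP i)
    inW   : ∀ i → i ∈ W → InG v W (varP i -P oneP)
    circ⁺ : ∀ C⁺ C⁻ → SignedCircuit ℝ v C⁺ C⁻ →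
            Nonempty (W ∩ C⁺) → W ∩ C⁺ ≡ W ∩ (C⁺ ∪ C⁻) →
            InG v W (setP (C⁺ ─ W) *P prodMinusOne C⁻)
    circ⁻ : ∀ C⁺ C⁻ → SignedCircuit ℝ v C⁺ C⁻ →
            Nonempty (W ∩ C⁻) → W ∩ C⁻ ≡ W ∩ (C⁺ ∪ C⁻) →
            InG v W (setP (C⁻ ─ W) *P prodMinusOne C⁺)
    circ⁰ : ∀ C⁺ C⁻ → SignedCircuit ℝ v C⁺ C⁻ →
            W ∩ (C⁺ ∪ C⁻) ≡ ⊥ →
            InG v W ((setP C⁺ *P prodMinusOne C⁻) -P (setP C⁻ *P prodMinusOne C⁺))

  IsStandard : ∀ {ℓ n} → (Fin n → Point ℝ ℓ) → Subset n → MonomialOrder n → Mono n → Set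
  IsStandard v W ord m = ∀ g → InG v W g → ∀ a → IsInitial ord g a → ¬ (a ∣M m)

-- The generators e_i² - e_i and e_i - 1 (i ∈ W) have initial monomials e_i² and e_i, so a standard
-- monomial is squarefree and avoids W: it is e_N with N ∩ W = ∅.  The generator of a signed circuit C
-- has initial monomial e_(C - min C) if C misses W, and e_(C⁺ - W) e_(C⁻) if W ∩ C ⊆ C⁺; either one
-- divides e_N as soon as the corresponding part of C lies in N, so N contains no broken circuit.
-- If the flat ⋂_{i ∈ N} H_i missed 𝒦, Motzkin's transposition theorem would give a linear dependency
-- supported on N ∪ W that is nonnegative and nonzero on W; shrinking its support yields a circuit C
-- with W ∩ C ⊆ C⁺, C⁺ - W ⊆ N and C⁻ ⊆ N, whose generator is then excluded in the same way.

module Submission where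

open import Data.Fin using (Fin)
open import Data.Nat using (ℕ)
open import Defs

module OrderedField (ℝ : RealField) where

  open RealField ℝ
  open import Algebra.Bundles using (CommutativeRing)
  open import Algebra.Solver.Ring.AlmostCommutativeRing
    using (fromCommutativeRing; _-Raw-AlmostCommutative⟶_)
  open import Data.Integer as ℤ using (ℤ; -[1+_])
  import Data.Integer.Properties as ℤ
  open import Data.Maybe using (Maybe; just; nothing)
  open import Data.Nat as ℕ using (suc; zero)
  import Data.Nat.Properties as ℕ
  import Data.Sign as Sign
  open import Data.Empty using (⊥-elim)
  open import Data.Product using (proj₁; proj₂)
  open import Data.Sum using (inj₁; inj₂)
  open import Relation.Binary.Definitions using (tri<; tri≈; tri>)
  open import Relation.Binary.PropositionalEquality
  open ≡-Reasoning
  open import Relation.Binary.Structures using (IsStrictTotalOrder)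
  open import Relation.Nullary using (¬_; yes; no)

  commutativeRing : CommutativeRing _ _
  commutativeRing = record { isCommutativeRing = isCommutativeRing }

  open CommutativeRing commutativeRing public
    using (+-assoc; +-comm; *-comm; +-identityˡ; +-identityʳ; *-identityˡ; *-identityʳ;
           -‿inverseʳ; distribˡ; distribʳ; zeroˡ; zeroʳ)
  open import Algebra.Properties.Ring (CommutativeRing.ring commutativeRing)
    using (-‿distribˡ-*; -‿distribʳ-*; -‿+-comm)
  open import Algebra.Properties.Ring (CommutativeRing.ring commutativeRing) public
    using (-0#≈0#; -‿involutive; -1*x≈-x)
  open IsStrictTotalOrder isStrictTotalOrder public
    using (compare; _≟_; _<?_) renaming (trans to <-trans; asym to <-asym)

  -- Equality in ℝ cannot be decided by computation, so the ring solver takes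
  -- its coefficients from ℤ, through the canonical morphism ℤ → ℝ.

  private
    open import Algebra.Properties.Semiring.Mult (CommutativeRing.semiring commutativeRing)
      using (_×_; ×-homo-+; ×1-homo-*)

    ⟦_⟧ : ℤ → Carrier
    ⟦ ℤ.+ n ⟧ = n × 1#
    ⟦ -[1+ n ] ⟧ = - (suc n × 1#)

    ⊖-homo : ∀ m n → ⟦ m ℤ.⊖ n ⟧ ≡ m × 1# + - (n × 1#)
    ⊖-homo m zero = begin
      ⟦ m ℤ.⊖ 0 ⟧       ≡⟨ cong ⟦_⟧ (ℤ.⊖-≥ {m} ℕ.z≤n) ⟩
      m × 1#            ≡⟨ sym (+-identityʳ _) ⟩
      m × 1# + 0#       ≡⟨ cong (m × 1# +_) (sym -0#≈0#) ⟩
      m × 1# + - 0#     ∎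
    ⊖-homo zero (suc n) = begin
      ⟦ 0 ℤ.⊖ suc n ⟧   ≡⟨ cong ⟦_⟧ (ℤ.⊖-≤ {0} {suc n} ℕ.z≤n) ⟩
      - (suc n × 1#)    ≡⟨ sym (+-identityˡ _) ⟩
      0# + - (suc n × 1#) ∎
    ⊖-homo (suc m) (suc n) = begin
      ⟦ suc m ℤ.⊖ suc n ⟧                  ≡⟨ cong ⟦_⟧ (ℤ.[1+m]⊖[1+n]≡m⊖n m n) ⟩
      ⟦ m ℤ.⊖ n ⟧                          ≡⟨ ⊖-homo m n ⟩
      a + - b                              ≡⟨ sym (+-identityˡ _) ⟩
      0# + (a + - b)                       ≡⟨ cong (_+ (a + - b)) (sym (-‿inverseʳ 1#)) ⟩
      (1# + - 1#) + (a + - b)              ≡⟨ +-assoc 1# (- 1#) _ ⟩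
      1# + (- 1# + (a + - b))              ≡⟨ cong (1# +_) (sym (+-assoc (- 1#) a _)) ⟩
      1# + ((- 1# + a) + - b)              ≡⟨ cong (λ z → 1# + (z + - b)) (+-comm (- 1#) a) ⟩
      1# + ((a + - 1#) + - b)              ≡⟨ cong (1# +_) (+-assoc a (- 1#) _) ⟩
      1# + (a + (- 1# + - b))              ≡⟨ sym (+-assoc 1# a _) ⟩
      (1# + a) + (- 1# + - b)              ≡⟨ cong ((1# + a) +_) (-‿+-comm 1# b) ⟩
      (1# + a) + - (1# + b)                ∎
      where a = m × 1#; b = n × 1#

    +-homo : ∀ i j → ⟦ i ℤ.+ j ⟧ ≡ ⟦ i ⟧ + ⟦ j ⟧
    +-homo (ℤ.+ m) (ℤ.+ n) = ×-homo-+ 1# m n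
    +-homo (ℤ.+ m) -[1+ n ] = ⊖-homo m (suc n)
    +-homo -[1+ m ] (ℤ.+ n) = trans (⊖-homo n (suc m)) (+-comm _ _)
    +-homo -[1+ m ] -[1+ n ] = begin
      - (suc (suc (m ℕ.+ n)) × 1#)            ≡⟨ cong (λ k → - (suc k × 1#)) (sym (ℕ.+-suc m n)) ⟩
      - ((suc m ℕ.+ suc n) × 1#)              ≡⟨ cong -_ (×-homo-+ 1# (suc m) (suc n)) ⟩
      - (suc m × 1# + suc n × 1#)             ≡⟨ sym (-‿+-comm _ _) ⟩
      - (suc m × 1#) + - (suc n × 1#)         ∎

    -‿homo : ∀ i → ⟦ ℤ.- i ⟧ ≡ - ⟦ i ⟧
    -‿homo -[1+ n ] = sym (-‿involutive _)
    -‿homo (ℤ.+ zero) = sym -0#≈0#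
    -‿homo (ℤ.+ suc n) = refl

    -x*-y≈x*y : ∀ x y → - x * - y ≡ x * y
    -x*-y≈x*y x y = begin
      - x * - y      ≡⟨ sym (-‿distribˡ-* x (- y)) ⟩
      - (x * - y)    ≡⟨ cong -_ (sym (-‿distribʳ-* x y)) ⟩
      - - (x * y)    ≡⟨ -‿involutive _ ⟩
      x * y          ∎

    *-homo : ∀ i j → ⟦ i ℤ.* j ⟧ ≡ ⟦ i ⟧ * ⟦ j ⟧
    *-homo (ℤ.+ m) (ℤ.+ n) = trans (cong ⟦_⟧ (ℤ.+◃n≡+n (m ℕ.* n))) (×1-homo-* m n)
    *-homo (ℤ.+ m) -[1+ n ] = begin
      ⟦ Sign.- ℤ.◃ (m ℕ.* suc n) ⟧         ≡⟨ cong ⟦_⟧ (ℤ.-◃n≡-n (m ℕ.* suc n)) ⟩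
      ⟦ ℤ.- (ℤ.+ (m ℕ.* suc n)) ⟧             ≡⟨ -‿homo (ℤ.+ (m ℕ.* suc n)) ⟩
      - ((m ℕ.* suc n) × 1#)              ≡⟨ cong -_ (×1-homo-* m (suc n)) ⟩
      - (m × 1# * suc n × 1#)             ≡⟨ -‿distribʳ-* _ _ ⟩
      m × 1# * - (suc n × 1#)             ∎
    *-homo -[1+ m ] (ℤ.+ n) = begin
      ⟦ Sign.- ℤ.◃ (suc m ℕ.* n) ⟧         ≡⟨ cong ⟦_⟧ (ℤ.-◃n≡-n (suc m ℕ.* n)) ⟩
      ⟦ ℤ.- (ℤ.+ (suc m ℕ.* n)) ⟧             ≡⟨ -‿homo (ℤ.+ (suc m ℕ.* n)) ⟩
      - ((suc m ℕ.* n) × 1#)              ≡⟨ cong -_ (×1-homo-* (suc m) n) ⟩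
      - (suc m × 1# * n × 1#)             ≡⟨ -‿distribˡ-* _ _ ⟩
      - (suc m × 1#) * n × 1#             ∎
    *-homo -[1+ m ] -[1+ n ] =
      trans (×1-homo-* (suc m) (suc n)) (sym (-x*-y≈x*y (suc m × 1#) (suc n × 1#)))

    coefficientMorphism : ℤ.+-*-rawRing -Raw-AlmostCommutative⟶ fromCommutativeRing commutativeRing
    coefficientMorphism = record
      { ⟦_⟧ = ⟦_⟧ ; +-homo = +-homo ; *-homo = *-homo ; -‿homo = -‿homo
      ; 0-homo = refl ; 1-homo = +-identityʳ 1# }

    ⟦⟧-≟ : ∀ i j → Maybe (⟦ i ⟧ ≡ ⟦ j ⟧)
    ⟦⟧-≟ i j with i ℤ.≟ j
    ... | yes i≡j = just (cong ⟦_⟧ i≡j)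
    ... | no _ = nothing

  open import Algebra.Solver.Ring ℤ.+-*-rawRing (fromCommutativeRing commutativeRing)
    coefficientMorphism ⟦⟧-≟ public
    using (solve; _:=_; _:+_; _:*_; :-_)

  <-irrefl : ∀ {x} → ¬ x < x
  <-irrefl = IsStrictTotalOrder.irrefl isStrictTotalOrder refl

  <⇒≢ : ∀ {x y} → x < y → x ≢ y
  <⇒≢ x<y refl = <-irrefl x<y

  >⇒≢ : ∀ {x y} → y < x → x ≢ y
  >⇒≢ y<x x≡y = <⇒≢ y<x (sym x≡y)

  <-≤-trans : ∀ {x y z} → x < y → y ≤ᵣ z → x < z
  <-≤-trans x<y (inj₁ y<z) = <-trans x<y y<z
  <-≤-trans x<y (inj₂ refl) = x<y

  ≤-trans : ∀ {x y z} → x ≤ᵣ y → y ≤ᵣ z → x ≤ᵣ z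
  ≤-trans (inj₁ x<y) y≤z = inj₁ (<-≤-trans x<y y≤z)
  ≤-trans (inj₂ refl) y≤z = y≤z

  ≮⇒≥ : ∀ {x y} → ¬ x < y → y ≤ᵣ x
  ≮⇒≥ {x} {y} x≮y with compare x y
  ... | tri< x<y _ _ = ⊥-elim (x≮y x<y)
  ... | tri≈ _ x≡y _ = inj₂ (sym x≡y)
  ... | tri> _ _ y<x = inj₁ y<x

  ≤⇒≯ : ∀ {x y} → x ≤ᵣ y → ¬ y < x
  ≤⇒≯ (inj₁ x<y) y<x = <-asym x<y y<x
  ≤⇒≯ (inj₂ refl) x<x = <-irrefl x<x

  ≥∧≢⇒> : ∀ {x} → 0# ≤ᵣ x → x ≢ 0# → 0# < x
  ≥∧≢⇒> (inj₁ 0<x) _ = 0<x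
  ≥∧≢⇒> (inj₂ 0≡x) x≢0 = ⊥-elim (x≢0 (sym 0≡x))

  +-monoʳ-< : ∀ {x y} z → x < y → z + x < z + y
  +-monoʳ-< {x} {y} z x<y = subst₂ _<_ (+-comm x z) (+-comm y z) (+-mono-< z x<y)

  +-monoˡ-≤ : ∀ {x y} z → x ≤ᵣ y → x + z ≤ᵣ y + z
  +-monoˡ-≤ z (inj₁ x<y) = inj₁ (+-mono-< z x<y)
  +-monoˡ-≤ z (inj₂ refl) = inj₂ refl

  +-monoʳ-≤ : ∀ {x y} z → x ≤ᵣ y → z + x ≤ᵣ z + y
  +-monoʳ-≤ z (inj₁ x<y) = inj₁ (+-monoʳ-< z x<y)
  +-monoʳ-≤ z (inj₂ refl) = inj₂ refl

  x≤y⇒0≤y-x : ∀ {x y} → x ≤ᵣ y → 0# ≤ᵣ y + - x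
  x≤y⇒0≤y-x {x} x≤y = subst (_≤ᵣ _) (-‿inverseʳ x) (+-monoˡ-≤ (- x) x≤y)

  pos⇒neg : ∀ {x} → 0# < x → - x < 0#
  pos⇒neg {x} 0<x = subst₂ _<_ (+-identityˡ (- x)) (-‿inverseʳ x) (+-mono-< (- x) 0<x)

  neg⇒pos : ∀ {x} → x < 0# → 0# < - x
  neg⇒pos {x} x<0 = subst₂ _<_ (-‿inverseʳ x) (+-identityˡ (- x)) (+-mono-< (- x) x<0)

  nonPos⇒nonNeg : ∀ {x} → x ≤ᵣ 0# → 0# ≤ᵣ - x
  nonPos⇒nonNeg (inj₁ x<0) = inj₁ (neg⇒pos x<0)
  nonPos⇒nonNeg (inj₂ refl) = inj₂ (sym -0#≈0#)

  pos+nonNeg⇒pos : ∀ {x y} → 0# < x → 0# ≤ᵣ y → 0# < x + y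
  pos+nonNeg⇒pos {x} {y} 0<x 0≤y =
    <-≤-trans 0<x (subst (_≤ᵣ x + y) (+-identityʳ x) (+-monoʳ-≤ x 0≤y))

  nonNeg+pos⇒pos : ∀ {x y} → 0# ≤ᵣ x → 0# < y → 0# < x + y
  nonNeg+pos⇒pos {x} {y} 0≤x 0<y = subst (0# <_) (+-comm y x) (pos+nonNeg⇒pos 0<y 0≤x)

  nonNeg+nonNeg⇒nonNeg : ∀ {x y} → 0# ≤ᵣ x → 0# ≤ᵣ y → 0# ≤ᵣ x + y
  nonNeg+nonNeg⇒nonNeg (inj₁ 0<x) 0≤y = inj₁ (pos+nonNeg⇒pos 0<x 0≤y)
  nonNeg+nonNeg⇒nonNeg {y = y} (inj₂ refl) 0≤y = subst (0# ≤ᵣ_) (sym (+-identityˡ y)) 0≤y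

  pos*neg⇒neg : ∀ {x y} → 0# < x → y < 0# → x * y < 0#
  pos*neg⇒neg {x} {y} 0<x y<0 =
    subst (_< 0#) (solve 2 (λ x y → :- (x :* :- y) := x :* y) refl x y) (pos⇒neg (*-pos 0<x (neg⇒pos y<0)))

  neg*neg⇒pos : ∀ {x y} → x < 0# → y < 0# → 0# < x * y
  neg*neg⇒pos {x} {y} x<0 y<0 =
    subst (0# <_) (solve 2 (λ x y → :- x :* :- y := x :* y) refl x y) (*-pos (neg⇒pos x<0) (neg⇒pos y<0))

  nonNeg*nonNeg⇒nonNeg : ∀ {x y} → 0# ≤ᵣ x → 0# ≤ᵣ y → 0# ≤ᵣ x * y
  nonNeg*nonNeg⇒nonNeg (inj₁ 0<x) (inj₁ 0<y) = inj₁ (*-pos 0<x 0<y)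
  nonNeg*nonNeg⇒nonNeg {x} (inj₁ _) (inj₂ refl) = inj₂ (sym (zeroʳ x))
  nonNeg*nonNeg⇒nonNeg {y = y} (inj₂ refl) _ = inj₂ (sym (zeroˡ y))

  nonPos*nonPos⇒nonNeg : ∀ {x y} → x ≤ᵣ 0# → y ≤ᵣ 0# → 0# ≤ᵣ x * y
  nonPos*nonPos⇒nonNeg (inj₁ x<0) (inj₁ y<0) = inj₁ (neg*neg⇒pos x<0 y<0)
  nonPos*nonPos⇒nonNeg {x} (inj₁ _) (inj₂ refl) = inj₂ (sym (zeroʳ x))
  nonPos*nonPos⇒nonNeg {y = y} (inj₂ refl) _ = inj₂ (sym (zeroˡ y))

  nonNeg*nonPos⇒nonPos : ∀ {x y} → 0# ≤ᵣ x → y ≤ᵣ 0# → x * y ≤ᵣ 0#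
  nonNeg*nonPos⇒nonPos (inj₁ 0<x) (inj₁ y<0) = inj₁ (pos*neg⇒neg 0<x y<0)
  nonNeg*nonPos⇒nonPos {x} (inj₁ _) (inj₂ refl) = inj₂ (zeroʳ x)
  nonNeg*nonPos⇒nonPos {y = y} (inj₂ refl) _ = inj₂ (zeroˡ y)

  *-monoˡ-≤-neg : ∀ {x y z} → z < 0# → x ≤ᵣ y → y * z ≤ᵣ x * z
  *-monoˡ-≤-neg {x} {y} {z} z<0 x≤y =
    subst₂ _≤ᵣ_ (solve 3 (λ x y z → x :* z :+ (y :+ :- x) :* z := y :* z) refl x y z) (+-identityʳ (x * z))
      (+-monoʳ-≤ (x * z) (nonNeg*nonPos⇒nonPos (x≤y⇒0≤y-x x≤y) (inj₁ z<0)))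

  square-pos : ∀ {x} → x ≢ 0# → 0# < x * x
  square-pos {x} x≢0 with compare x 0#
  ... | tri< x<0 _ _ = neg*neg⇒pos x<0 x<0
  ... | tri≈ _ x≡0 _ = ⊥-elim (x≢0 x≡0)
  ... | tri> _ _ 0<x = *-pos 0<x 0<x

  square-nonNeg : ∀ x → 0# ≤ᵣ x * x
  square-nonNeg x with x ≟ 0#
  ... | yes refl = inj₂ (sym (zeroʳ 0#))
  ... | no x≢0 = inj₁ (square-pos x≢0)

  0<1 : 0# < 1#
  0<1 with compare 0# 1#
  ... | tri< 0<1 _ _ = 0<1
  ... | tri≈ _ 0≡1 _ = ⊥-elim (0≢1 0≡1)
  ... | tri> _ _ 1<0 = ⊥-elim (<-asym 1<0 (subst (0# <_) (*-identityˡ 1#) (neg*neg⇒pos 1<0 1<0)))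

  -- The junk value 0⁻¹ = 0 keeps _⁻¹ total.

  _⁻¹ : Carrier → Carrier
  x ⁻¹ with x ≟ 0#
  ... | yes _ = 0#
  ... | no x≢0 = proj₁ (inverse x x≢0)

  *-inverseʳ : ∀ x → x ≢ 0# → x * x ⁻¹ ≡ 1#
  *-inverseʳ x x≢0 with x ≟ 0#
  ... | yes x≡0 = ⊥-elim (x≢0 x≡0)
  ... | no x≢0 = proj₂ (inverse x x≢0)

  ⁻¹-pos : ∀ {x} → 0# < x → 0# < x ⁻¹
  ⁻¹-pos {x} 0<x with compare 0# (x ⁻¹)
  ... | tri< 0<x⁻¹ _ _ = 0<x⁻¹
  ... | tri≈ _ 0≡x⁻¹ _ = ⊥-elim (0≢1 (begin
    0#         ≡⟨ sym (zeroʳ x) ⟩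
    x * 0#     ≡⟨ cong (x *_) 0≡x⁻¹ ⟩
    x * x ⁻¹   ≡⟨ *-inverseʳ x (>⇒≢ 0<x) ⟩
    1#         ∎))
  ... | tri> _ _ x⁻¹<0 = ⊥-elim (<-asym 0<1 (subst (_< 0#) (*-inverseʳ x (>⇒≢ 0<x)) (pos*neg⇒neg 0<x x⁻¹<0)))

module LinearAlgebra (ℝ : RealField) where

  open RealField ℝ
  open OrderedField ℝ
  open import Data.Bool using (if_then_else_)
  open import Data.Fin using (Fin; zero; suc)
  import Data.Fin as Fin
  open import Data.Nat using (ℕ)
  open import Data.Product using (∃; _,_)
  open import Data.Sum using (_⊎_; inj₁; inj₂)
  open import Relation.Binary.PropositionalEquality
  open import Relation.Nullary using (does; yes; no)
  open ≡-Reasoning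

  private
    variable
      k ℓ : ℕ

  ∑-cong : {f g : Fin k → Carrier} → (∀ i → f i ≡ g i) → ∑ ℝ f ≡ ∑ ℝ g
  ∑-cong {ℕ.zero} f≡g = refl
  ∑-cong {ℕ.suc k} f≡g = cong₂ _+_ (f≡g zero) (∑-cong (λ i → f≡g (suc i)))

  ∑-zero : (f : Fin k → Carrier) → (∀ i → f i ≡ 0#) → ∑ ℝ f ≡ 0#
  ∑-zero {ℕ.zero} f f≡0 = refl
  ∑-zero {ℕ.suc k} f f≡0 =
    trans (cong₂ _+_ (f≡0 zero) (∑-zero (λ i → f (suc i)) (λ i → f≡0 (suc i)))) (+-identityˡ 0#)

  ∑-distrib-+ : (f g : Fin k → Carrier) → ∑ ℝ (λ i → f i + g i) ≡ ∑ ℝ f + ∑ ℝ g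
  ∑-distrib-+ {ℕ.zero} f g = sym (+-identityˡ 0#)
  ∑-distrib-+ {ℕ.suc k} f g = begin
    (f zero + g zero) + ∑ ℝ (λ i → f (suc i) + g (suc i))
      ≡⟨ cong ((f zero + g zero) +_) (∑-distrib-+ (λ i → f (suc i)) (λ i → g (suc i))) ⟩
    (f zero + g zero) + (∑ ℝ (λ i → f (suc i)) + ∑ ℝ (λ i → g (suc i)))
      ≡⟨ solve 4 (λ a b c d → (a :+ b) :+ (c :+ d) := (a :+ c) :+ (b :+ d)) refl _ _ _ _ ⟩
    (f zero + ∑ ℝ (λ i → f (suc i))) + (g zero + ∑ ℝ (λ i → g (suc i))) ∎

  ∑-*ˡ : ∀ c (f : Fin k → Carrier) → ∑ ℝ (λ i → c * f i) ≡ c * ∑ ℝ f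
  ∑-*ˡ {ℕ.zero} c f = sym (zeroʳ c)
  ∑-*ˡ {ℕ.suc k} c f =
    trans (cong (c * f zero +_) (∑-*ˡ c (λ i → f (suc i)))) (sym (distribˡ c _ _))

  ∑-*ʳ : ∀ c (f : Fin k → Carrier) → ∑ ℝ (λ i → f i * c) ≡ ∑ ℝ f * c
  ∑-*ʳ c f = trans (∑-cong (λ i → *-comm (f i) c)) (trans (∑-*ˡ c f) (*-comm c _))

  ∑-comm : ∀ {m} (f : Fin k → Fin m → Carrier) →
           ∑ ℝ (λ i → ∑ ℝ (λ j → f i j)) ≡ ∑ ℝ (λ j → ∑ ℝ (λ i → f i j))
  ∑-comm {ℕ.zero} {m} f = sym (∑-zero {m} _ (λ _ → refl))
  ∑-comm {ℕ.suc k} f = begin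
    ∑ ℝ (f zero) + ∑ ℝ (λ i → ∑ ℝ (f (suc i)))  ≡⟨ cong (∑ ℝ (f zero) +_) (∑-comm (λ i → f (suc i))) ⟩
    ∑ ℝ (f zero) + ∑ ℝ (λ j → ∑ ℝ (λ i → f (suc i) j)) ≡⟨ sym (∑-distrib-+ (f zero) _) ⟩
    ∑ ℝ (λ j → ∑ ℝ (λ i → f i j))                ∎

  ∑-nonNeg : (f : Fin k → Carrier) → (∀ i → 0# ≤ᵣ f i) → 0# ≤ᵣ ∑ ℝ f
  ∑-nonNeg {ℕ.zero} f _ = inj₂ refl
  ∑-nonNeg {ℕ.suc k} f 0≤f = nonNeg+nonNeg⇒nonNeg (0≤f zero) (∑-nonNeg (λ i → f (suc i)) (λ i → 0≤f (suc i)))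

  ∑-pos : (f : Fin k → Carrier) → (∀ i → 0# ≤ᵣ f i) → ∀ j → 0# < f j → 0# < ∑ ℝ f
  ∑-pos f 0≤f zero 0<fj = pos+nonNeg⇒pos 0<fj (∑-nonNeg (λ i → f (suc i)) (λ i → 0≤f (suc i)))
  ∑-pos f 0≤f (suc j) 0<fj = nonNeg+pos⇒pos (0≤f zero) (∑-pos (λ i → f (suc i)) (λ i → 0≤f (suc i)) j 0<fj)

  infix 8 _∙_

  _∙_ : Point ℝ ℓ → Point ℝ ℓ → Carrier
  _∙_ = _·_ ℝ

  0ᵥ : Point ℝ ℓ
  0ᵥ _ = 0#

  infixl 6 _+ᵥ_
  infixl 7 _*ᵥ_

  _+ᵥ_ : Point ℝ ℓ → Point ℝ ℓ → Point ℝ ℓ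
  (x +ᵥ y) t = x t + y t

  _*ᵥ_ : Carrier → Point ℝ ℓ → Point ℝ ℓ
  (c *ᵥ x) t = c * x t

  unit : Fin ℓ → Point ℝ ℓ
  unit s t = if does (s Fin.≟ t) then 1# else 0#

  lincomb : (Fin k → Carrier) → (Fin k → Point ℝ ℓ) → Point ℝ ℓ
  lincomb c E t = ∑ ℝ (λ i → c i * E i t)

  nonzero-coordinate : (u : Point ℝ ℓ) → (∀ t → u t ≡ 0#) ⊎ ∃ λ t → u t ≢ 0#
  nonzero-coordinate {ℕ.zero} u = inj₁ (λ ())
  nonzero-coordinate {ℕ.suc ℓ} u with u zero ≟ 0#
  ... | no u₀≢0 = inj₂ (zero , u₀≢0)
  ... | yes u₀≡0 with nonzero-coordinate (λ t → u (suc t))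
  ...   | inj₁ u≡0 = inj₁ (λ { zero → u₀≡0 ; (suc t) → u≡0 t })
  ...   | inj₂ (t , ut≢0) = inj₂ (suc t , ut≢0)

  ∙-comm : (u x : Point ℝ ℓ) → u ∙ x ≡ x ∙ u
  ∙-comm u x = ∑-cong (λ t → *-comm (u t) (x t))

  ∙-congˡ : {u v : Point ℝ ℓ} (x : Point ℝ ℓ) → (∀ t → u t ≡ v t) → u ∙ x ≡ v ∙ x
  ∙-congˡ x u≡v = ∑-cong (λ t → cong (_* x t) (u≡v t))

  ∙-zeroˡ : {u : Point ℝ ℓ} (x : Point ℝ ℓ) → (∀ t → u t ≡ 0#) → u ∙ x ≡ 0#
  ∙-zeroˡ x u≡0 = trans (∙-congˡ x u≡0) (∑-zero _ (λ t → zeroˡ (x t)))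

  ∙-distribʳ-+ᵥ : (u x y : Point ℝ ℓ) → u ∙ (x +ᵥ y) ≡ u ∙ x + u ∙ y
  ∙-distribʳ-+ᵥ u x y = trans (∑-cong (λ t → distribˡ (u t) (x t) (y t))) (∑-distrib-+ (λ t → u t * x t) (λ t → u t * y t))

  ∙-distribˡ-+ᵥ : (u v x : Point ℝ ℓ) → (u +ᵥ v) ∙ x ≡ u ∙ x + v ∙ x
  ∙-distribˡ-+ᵥ u v x = trans (∑-cong (λ t → distribʳ (x t) (u t) (v t))) (∑-distrib-+ (λ t → u t * x t) (λ t → v t * x t))

  ∙-*ᵥʳ : ∀ (u x : Point ℝ ℓ) c → u ∙ (c *ᵥ x) ≡ c * u ∙ x
  ∙-*ᵥʳ u x c = trans (∑-cong (λ t → solve 3 (λ u c x → u :* (c :* x) := c :* (u :* x)) refl (u t) c (x t)))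
                      (∑-*ˡ c (λ t → u t * x t))

  ∙-*ᵥˡ : ∀ (u x : Point ℝ ℓ) c → (c *ᵥ u) ∙ x ≡ c * u ∙ x
  ∙-*ᵥˡ u x c = trans (∙-comm (c *ᵥ u) x) (trans (∙-*ᵥʳ x u c) (cong (c *_) (∙-comm x u)))

  ∙-unitʳ : ∀ (u : Point ℝ ℓ) t → u ∙ unit t ≡ u t
  ∙-unitʳ {ℕ.suc ℓ} u zero =
    trans (cong₂ _+_ (*-identityʳ (u zero)) (∑-zero _ (λ i → zeroʳ (u (suc i))))) (+-identityʳ _)
  ∙-unitʳ {ℕ.suc ℓ} u (suc t) =
    trans (cong₂ _+_ (zeroʳ (u zero)) (∙-unitʳ (λ i → u (suc i)) t)) (+-identityˡ _)

  ∙-self-pos : ∀ (u : Point ℝ ℓ) t → u t ≢ 0# → 0# < u ∙ u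
  ∙-self-pos u t ut≢0 = ∑-pos _ (λ s → square-nonNeg (u s)) t (square-pos ut≢0)

  lincomb-∙ : ∀ (c : Fin k → Carrier) (E : Fin k → Point ℝ ℓ) x →
              lincomb c E ∙ x ≡ ∑ ℝ (λ i → c i * E i ∙ x)
  lincomb-∙ c E x = begin
    ∑ ℝ (λ t → ∑ ℝ (λ i → c i * E i t) * x t)
      ≡⟨ ∑-cong (λ t → trans (*-comm _ (x t)) (sym (∑-*ˡ (x t) (λ i → c i * E i t)))) ⟩
    ∑ ℝ (λ t → ∑ ℝ (λ i → x t * (c i * E i t)))
      ≡⟨ ∑-comm (λ t i → x t * (c i * E i t)) ⟩
    ∑ ℝ (λ i → ∑ ℝ (λ t → x t * (c i * E i t)))
      ≡⟨ ∑-cong (λ i → trans (∑-cong (λ t → rearrange (x t) (c i) (E i t))) (∑-*ˡ (c i) (λ t → E i t * x t))) ⟩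
    ∑ ℝ (λ i → c i * E i ∙ x)              ∎
    where
    rearrange : ∀ a b c → a * (b * c) ≡ b * (c * a)
    rearrange = solve 3 (λ a b c → a :* (b :* c) := b :* (c :* a)) refl

module Motzkin (ℝ : RealField) where

  open RealField ℝ
  open OrderedField ℝ
  open LinearAlgebra ℝ
  open import Data.Bool using (Bool; true; false)
  open import Data.Empty using (⊥-elim)
  open import Data.Fin using (Fin; zero; suc)
  open import Data.Nat using (ℕ)
  open import Data.Product using (∃; ∃₂; _×_; _,_)
  open import Data.Sum using (_⊎_; inj₁; inj₂)
  open import Data.Vec.Functional using (_∷_; tail)
  open import Relation.Binary.Definitions using (tri<; tri≈; tri>)
  open import Relation.Binary.PropositionalEquality
  open import Relation.Nullary using (yes; no)
  open ≡-Reasoning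

  private
    variable
      ℓ p q : ℕ

    true≢false : true ≢ false
    true≢false ()

  shrink-perturbation : ∀ {ε ε′ a b} → 0# < ε′ → ε′ ≤ᵣ ε → 0# < a →
                        0# < a + ε * b → 0# < a + ε′ * b
  shrink-perturbation {ε} {ε′} {a} {b} 0<ε′ ε′≤ε 0<a 0<a+εb with compare b 0#
  ... | tri< b<0 _ _ = subst (0# <_) eq
          (pos+nonNeg⇒pos 0<a+εb (nonPos⇒nonNeg (nonNeg*nonPos⇒nonPos (x≤y⇒0≤y-x ε′≤ε) (inj₁ b<0))))
    where
    eq : a + ε * b + - ((ε + - ε′) * b) ≡ a + ε′ * b
    eq = solve 4 (λ a ε b ε′ → a :+ ε :* b :+ :- ((ε :+ :- ε′) :* b) := a :+ ε′ :* b) refl a ε b ε′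
  ... | tri≈ _ b≡0 _ = pos+nonNeg⇒pos 0<a (nonNeg*nonNeg⇒nonNeg (inj₁ 0<ε′) (inj₂ (sym b≡0)))
  ... | tri> _ _ 0<b = pos+nonNeg⇒pos 0<a (nonNeg*nonNeg⇒nonNeg (inj₁ 0<ε′) (inj₁ 0<b))

  -- For b < 0 take ε = a (a - b)⁻¹, so that a + ε b = a² (a - b)⁻¹.
  perturbation : ∀ {a} b → 0# < a → ∃ λ ε → 0# < ε × 0# < a + ε * b
  perturbation {a} b 0<a with compare b 0#
  ... | tri< b<0 _ _ = a * w , *-pos 0<a 0<w , subst (0# <_) eq (*-pos (*-pos 0<a 0<w) 0<a)
    where
    0<a-b : 0# < a + - b
    0<a-b = pos+nonNeg⇒pos 0<a (inj₁ (neg⇒pos b<0))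
    w = (a + - b) ⁻¹
    0<w : 0# < w
    0<w = ⁻¹-pos 0<a-b
    eq : a * w * a ≡ a + a * w * b
    eq = begin
      a * w * a                          ≡⟨ solve 3 (λ a w b → a :* w :* a := a :* ((a :+ :- b) :* w) :+ a :* w :* b) refl a w b ⟩
      a * ((a + - b) * w) + a * w * b    ≡⟨ cong (λ z → a * z + a * w * b) (*-inverseʳ (a + - b) (>⇒≢ 0<a-b)) ⟩
      a * 1# + a * w * b                 ≡⟨ cong (_+ a * w * b) (*-identityʳ a) ⟩
      a + a * w * b                      ∎
  ... | tri≈ _ b≡0 _ = 1# , 0<1 , pos+nonNeg⇒pos 0<a (inj₂ (sym (trans (cong (1# *_) b≡0) (zeroʳ 1#))))
  ... | tri> _ _ 0<b = 1# , 0<1 , pos+nonNeg⇒pos 0<a (inj₁ (*-pos 0<1 0<b))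

  perturbations : ∀ {q} (m : Fin q → Bool) (a b : Fin q → Carrier) → (∀ j → m j ≡ true → 0# < a j) →
                  ∃ λ ε → 0# < ε × (∀ j → m j ≡ true → 0# < a j + ε * b j)
  perturbations {ℕ.zero} m a b _ = 1# , 0<1 , λ ()
  perturbations {ℕ.suc q} m a b 0<a with perturbations (tail m) (tail a) (tail b) (λ j → 0<a (suc j))
  ... | ε′ , 0<ε′ , ε′-ok with m zero in m₀
  ...   | false = ε′ , 0<ε′ , λ { zero m₀≡true → ⊥-elim (true≢false (trans (sym m₀≡true) m₀))
                               ; (suc j) → ε′-ok j }
  ...   | true with perturbation (b zero) (0<a zero m₀)
  ...     | ε₀ , 0<ε₀ , ε₀-ok with compare ε₀ ε′
  ...       | tri< ε₀<ε′ _ _ = ε₀ , 0<ε₀ , λ { zero _ → ε₀-ok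
                                           ; (suc j) mj → shrink-perturbation 0<ε₀ (inj₁ ε₀<ε′) (0<a (suc j) mj) (ε′-ok j mj) }
  ...       | tri≈ _ refl _ = ε₀ , 0<ε₀ , λ { zero _ → ε₀-ok ; (suc j) → ε′-ok j }
  ...       | tri> _ _ ε′<ε₀ = ε′ , 0<ε′ , λ { zero _ → shrink-perturbation 0<ε′ (inj₁ ε′<ε₀) (0<a zero m₀) ε₀-ok
                                           ; (suc j) → ε′-ok j }

  record System (ℓ p q : ℕ) : Set where
    field
      eq     : Fin p → Point ℝ ℓ
      eq?    : Fin p → Bool
      ineq   : Fin q → Point ℝ ℓ
      ineq?  : Fin q → Bool

  open System

  Solution : System ℓ p q → Point ℝ ℓ → Set
  Solution σ x = (∀ i → eq? σ i ≡ true → eq σ i ∙ x ≡ 0#) × (∀ j → ineq? σ j ≡ true → 0# < ineq σ j ∙ x)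

  Certificate : System ℓ p q → Set
  Certificate σ = ∃₂ λ (λᵉ : Fin _ → Carrier) (λⁱ : Fin _ → Carrier) →
    (∀ t → lincomb λᵉ (eq σ) t + lincomb λⁱ (ineq σ) t ≡ 0#) ×
    (∀ i → eq? σ i ≡ false → λᵉ i ≡ 0#) × (∀ j → ineq? σ j ≡ false → λⁱ j ≡ 0#) ×
    (∀ j → 0# ≤ᵣ λⁱ j) × ∃ λ j → 0# < λⁱ j

  Alternative : System ℓ p q → Set
  Alternative σ = (∃ λ x → Solution σ x) ⊎ Certificate σ

  dropEquation : System ℓ (ℕ.suc p) q → System ℓ p q
  dropEquation σ = record { eq = tail (eq σ) ; eq? = tail (eq? σ) ; ineq = ineq σ ; ineq? = ineq? σ }

  dropInequality : System ℓ p (ℕ.suc q) → System ℓ p q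
  dropInequality σ = record { eq = eq σ ; eq? = eq? σ ; ineq = tail (ineq σ) ; ineq? = tail (ineq? σ) }

  promoteInequality : System ℓ 0 (ℕ.suc q) → System ℓ 1 q
  promoteInequality σ = record { eq = λ _ → ineq σ zero ; eq? = λ _ → true ; ineq = tail (ineq σ) ; ineq? = tail (ineq? σ) }

  alternative-dropEquation : (σ : System ℓ (ℕ.suc p) q) → eq? σ zero ≡ false ⊎ (∀ t → eq σ zero t ≡ 0#) →
                             Alternative (dropEquation σ) → Alternative σ
  alternative-dropEquation σ trivial (inj₁ (x , eqs , ineqs)) = inj₁ (x , eqs′ , ineqs)
    where
    eqs′ : ∀ i → eq? σ i ≡ true → eq σ i ∙ x ≡ 0#
    eqs′ zero = trivial-equation trivial
      where
      trivial-equation : eq? σ zero ≡ false ⊎ (∀ t → eq σ zero t ≡ 0#) → eq? σ zero ≡ true → eq σ zero ∙ x ≡ 0#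
      trivial-equation (inj₁ off) on = ⊥-elim (true≢false (trans (sym on) off))
      trivial-equation (inj₂ eq₀≡0) _ = ∙-zeroˡ x eq₀≡0
    eqs′ (suc i) = eqs i
  alternative-dropEquation σ _ (inj₂ (λᵉ , λⁱ , dep , offᵉ , offⁱ , λⁱ≥0 , λⁱ>0)) =
    inj₂ (0# ∷ λᵉ , λⁱ , dep′ , (λ { zero _ → refl ; (suc i) → offᵉ i }) , offⁱ , λⁱ≥0 , λⁱ>0)
    where
    dep′ : ∀ t → (0# * eq σ zero t + lincomb λᵉ (tail (eq σ)) t) + lincomb λⁱ (ineq σ) t ≡ 0#
    dep′ t = begin
      0# * eq σ zero t + L + M  ≡⟨ cong (λ z → z + L + M) (zeroˡ (eq σ zero t)) ⟩
      0# + L + M                ≡⟨ cong (_+ M) (+-identityˡ L) ⟩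
      L + M                     ≡⟨ dep t ⟩
      0#                        ∎
      where L = lincomb λᵉ (tail (eq σ)) t
            M = lincomb λⁱ (ineq σ) t

  -- Gaussian elimination of the coordinate t by means of a vector b with b t ≠ 0
  module Pivot (b : Point ℝ ℓ) (t : Fin ℓ) (bt≢0 : b t ≢ 0#) where

    reduce : Point ℝ ℓ → Point ℝ ℓ
    reduce u = u +ᵥ (- (u t * b t ⁻¹)) *ᵥ b

    adjust : Point ℝ ℓ → Point ℝ ℓ
    adjust x = x +ᵥ (- (b ∙ x * b t ⁻¹)) *ᵥ unit t

    ∙-adjust : ∀ u x → u ∙ adjust x ≡ reduce u ∙ x
    ∙-adjust u x = begin
      u ∙ adjust x                                       ≡⟨ ∙-distribʳ-+ᵥ u x _ ⟩
      u ∙ x + u ∙ ((- (b ∙ x * b t ⁻¹)) *ᵥ unit t)       ≡⟨ cong (u ∙ x +_) (∙-*ᵥʳ u (unit t) _) ⟩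
      u ∙ x + - (b ∙ x * b t ⁻¹) * u ∙ unit t           ≡⟨ cong (λ z → u ∙ x + - (b ∙ x * b t ⁻¹) * z) (∙-unitʳ u t) ⟩
      u ∙ x + - (b ∙ x * b t ⁻¹) * u t                  ≡⟨ cong (u ∙ x +_) (swap (b ∙ x) (b t ⁻¹) (u t)) ⟩
      u ∙ x + - (u t * b t ⁻¹) * b ∙ x                  ≡⟨ cong (u ∙ x +_) (sym (∙-*ᵥˡ b x _)) ⟩
      u ∙ x + ((- (u t * b t ⁻¹)) *ᵥ b) ∙ x             ≡⟨ sym (∙-distribˡ-+ᵥ u _ x) ⟩
      reduce u ∙ x                                       ∎
        where
        swap : ∀ a β c → - (a * β) * c ≡ - (c * β) * a
        swap = solve 3 (λ a β c → :- (a :* β) :* c := :- (c :* β) :* a) refl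

    reduce-pivot : ∀ s → reduce b s ≡ 0#
    reduce-pivot s = begin
      b s + - (b t * b t ⁻¹) * b s   ≡⟨ cong (λ z → b s + - z * b s) (*-inverseʳ (b t) bt≢0) ⟩
      b s + - 1# * b s               ≡⟨ cong (b s +_) (-1*x≈-x (b s)) ⟩
      b s + - b s                    ≡⟨ -‿inverseʳ (b s) ⟩
      0#                             ∎

    lincomb-reduce : ∀ {k} (c : Fin k → Carrier) (F : Fin k → Point ℝ ℓ) s →
                     lincomb c (λ i → reduce (F i)) s ≡ lincomb c F s + - (lincomb c F t * b t ⁻¹) * b s
    lincomb-reduce c F s = begin
      ∑ ℝ (λ i → c i * (F i s + - (F i t * β) * b s))
        ≡⟨ ∑-cong (λ i → expand (c i) (F i s) (F i t) β (b s)) ⟩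
      ∑ ℝ (λ i → c i * F i s + c i * F i t * (- (β * b s)))
        ≡⟨ ∑-distrib-+ (λ i → c i * F i s) (λ i → c i * F i t * (- (β * b s))) ⟩
      lincomb c F s + ∑ ℝ (λ i → c i * F i t * (- (β * b s)))
        ≡⟨ cong (lincomb c F s +_) (∑-*ʳ (- (β * b s)) (λ i → c i * F i t)) ⟩
      lincomb c F s + lincomb c F t * (- (β * b s))
        ≡⟨ cong (lincomb c F s +_) (regroup (lincomb c F t) β (b s)) ⟩
      lincomb c F s + - (lincomb c F t * β) * b s ∎
      where
      β = b t ⁻¹
      expand : ∀ c x y β z → c * (x + - (y * β) * z) ≡ c * x + c * y * (- (β * z))
      expand = solve 5 (λ c x y β z → c :* (x :+ :- (y :* β) :* z) := c :* x :+ c :* y :* (:- (β :* z))) refl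
      regroup : ∀ L β z → L * (- (β * z)) ≡ - (L * β) * z
      regroup = solve 3 (λ L β z → L :* (:- (β :* z)) := :- (L :* β) :* z) refl

  eliminate : (σ : System ℓ (ℕ.suc p) q) (t : Fin ℓ) → eq σ zero t ≢ 0# → System ℓ p q
  eliminate σ t b₀≢0 = record
    { eq = λ i → reduce (eq σ (suc i)) ; eq? = tail (eq? σ) ; ineq = λ j → reduce (ineq σ j) ; ineq? = ineq? σ }
    where open Pivot (eq σ zero) t b₀≢0

  alternative-eliminate : (σ : System ℓ (ℕ.suc p) q) → eq? σ zero ≡ true → ∀ t (b₀≢0 : eq σ zero t ≢ 0#) →
                          Alternative (eliminate σ t b₀≢0) → Alternative σ
  alternative-eliminate σ on t b₀≢0 (inj₁ (x , eqs , ineqs)) =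
    inj₁ (adjust x , eqs′ , λ j mj → subst (0# <_) (sym (∙-adjust (ineq σ j) x)) (ineqs j mj))
    where
    open Pivot (eq σ zero) t b₀≢0
    eqs′ : ∀ i → eq? σ i ≡ true → eq σ i ∙ adjust x ≡ 0#
    eqs′ zero _ = trans (∙-adjust (eq σ zero) x) (∙-zeroˡ x reduce-pivot)
    eqs′ (suc i) mi = trans (∙-adjust (eq σ (suc i)) x) (eqs i mi)
  alternative-eliminate σ on t b₀≢0 (inj₂ (λᵉ , λⁱ , dep , offᵉ , offⁱ , λⁱ≥0 , λⁱ>0)) =
    inj₂ (λ₀ ∷ λᵉ , λⁱ , dep′ , offᵉ′ , offⁱ , λⁱ≥0 , λⁱ>0)
    where
    open Pivot (eq σ zero) t b₀≢0
    E = tail (eq σ)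
    S = ineq σ
    β = eq σ zero t ⁻¹
    λ₀ = - ((lincomb λᵉ E t + lincomb λⁱ S t) * β)
    offᵉ′ : ∀ i → eq? σ i ≡ false → (λ₀ ∷ λᵉ) i ≡ 0#
    offᵉ′ zero off = ⊥-elim (true≢false (trans (sym on) off))
    offᵉ′ (suc i) = offᵉ i
    dep′ : ∀ s → λ₀ * eq σ zero s + lincomb λᵉ E s + lincomb λⁱ S s ≡ 0#
    dep′ s = begin
      λ₀ * eq σ zero s + lincomb λᵉ E s + lincomb λⁱ S s
        ≡⟨ solve 6 (λ A B A₀ B₀ β z → :- ((A₀ :+ B₀) :* β) :* z :+ A :+ B := (A :+ :- (A₀ :* β) :* z) :+ (B :+ :- (B₀ :* β) :* z))
             refl (lincomb λᵉ E s) (lincomb λⁱ S s) (lincomb λᵉ E t) (lincomb λⁱ S t) β (eq σ zero s) ⟩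
      (lincomb λᵉ E s + - (lincomb λᵉ E t * β) * eq σ zero s) + (lincomb λⁱ S s + - (lincomb λⁱ S t * β) * eq σ zero s)
        ≡⟨ sym (cong₂ _+_ (lincomb-reduce λᵉ E s) (lincomb-reduce λⁱ S s)) ⟩
      lincomb λᵉ (λ i → reduce (E i)) s + lincomb λⁱ (λ j → reduce (S j)) s
        ≡⟨ dep s ⟩
      0# ∎

  certificate-pairing : ∀ {q} (μ : Fin q → Carrier) (m : Fin q → Bool) (a : Fin q → Carrier) →
                        (∀ j → m j ≡ false → μ j ≡ 0#) → (∀ j → 0# ≤ᵣ μ j) → (∃ λ j → 0# < μ j) →
                        (∀ j → m j ≡ true → 0# < a j) → 0# < ∑ ℝ (λ j → μ j * a j)
  certificate-pairing μ m a off μ≥0 (j , μj>0) a>0 = ∑-pos _ term≥0 j (*-pos μj>0 (a>0 j (on j μj>0)))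
    where
    on : ∀ j → 0# < μ j → m j ≡ true
    on j μj>0 with m j in mj
    ... | true = refl
    ... | false = ⊥-elim (>⇒≢ μj>0 (off j mj))
    term≥0 : ∀ j → 0# ≤ᵣ μ j * a j
    term≥0 j with μ≥0 j
    ... | inj₁ μj>0 = inj₁ (*-pos μj>0 (a>0 j (on j μj>0)))
    ... | inj₂ 0≡μj = inj₂ (trans (sym (zeroˡ (a j))) (cong (_* a j) 0≡μj))

  certificate-promoted : (σ : System ℓ 0 (ℕ.suc q)) → ineq? σ zero ≡ true → ∀ x →
                         Solution (dropInequality σ) x → ineq σ zero ∙ x ≤ᵣ 0# →
                         Certificate (promoteInequality σ) → Certificate σ
  certificate-promoted σ on x (_ , ineqs) s₀x≤0 (λᵉ , λⁱ , dep , _ , offⁱ , λⁱ≥0 , (j , λⁱj>0)) with λᵉ zero <? 0#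
  ... | yes λ₀<0 = ⊥-elim (<-irrefl (subst (0# <_) pairing
          (nonNeg+pos⇒pos (nonPos*nonPos⇒nonNeg (inj₁ λ₀<0) s₀x≤0)
            (certificate-pairing λⁱ (tail (ineq? σ)) (λ j → tail (ineq σ) j ∙ x) offⁱ λⁱ≥0 (j , λⁱj>0) ineqs))))
    where
    pairing : λᵉ zero * ineq σ zero ∙ x + ∑ ℝ (λ j → λⁱ j * tail (ineq σ) j ∙ x) ≡ 0#
    pairing = begin
      λᵉ zero * ineq σ zero ∙ x + ∑ ℝ (λ j → λⁱ j * tail (ineq σ) j ∙ x)
        ≡⟨ cong (_+ ∑ ℝ (λ j → λⁱ j * tail (ineq σ) j ∙ x)) (sym (+-identityʳ _)) ⟩
      ∑ ℝ (λ i → λᵉ i * ineq σ zero ∙ x) + ∑ ℝ (λ j → λⁱ j * tail (ineq σ) j ∙ x)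
        ≡⟨ sym (cong₂ _+_ (lincomb-∙ λᵉ (eq (promoteInequality σ)) x) (lincomb-∙ λⁱ (tail (ineq σ)) x)) ⟩
      lincomb λᵉ (eq (promoteInequality σ)) ∙ x + lincomb λⁱ (tail (ineq σ)) ∙ x
        ≡⟨ sym (∙-distribˡ-+ᵥ _ _ x) ⟩
      (lincomb λᵉ (eq (promoteInequality σ)) +ᵥ lincomb λⁱ (tail (ineq σ))) ∙ x
        ≡⟨ ∙-zeroˡ x dep ⟩
      0# ∎
  ... | no λ₀≮0 = (λ ()) , λᵉ zero ∷ λⁱ , dep′ , (λ ()) , offⁱ′ , λⁱ′≥0 , (suc j , λⁱj>0)
    where
    dep′ : ∀ t → 0# + (λᵉ zero * ineq σ zero t + lincomb λⁱ (tail (ineq σ)) t) ≡ 0#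
    dep′ t = trans (+-identityˡ _) (trans (cong (_+ lincomb λⁱ (tail (ineq σ)) t) (sym (+-identityʳ _))) (dep t))
    offⁱ′ : ∀ j → ineq? σ j ≡ false → (λᵉ zero ∷ λⁱ) j ≡ 0#
    offⁱ′ zero off = ⊥-elim (true≢false (trans (sym on) off))
    offⁱ′ (suc j) = offⁱ j
    λⁱ′≥0 : ∀ j → 0# ≤ᵣ (λᵉ zero ∷ λⁱ) j
    λⁱ′≥0 zero = ≮⇒≥ λ₀≮0
    λⁱ′≥0 (suc j) = λⁱ≥0 j

  -- A solution y of the promoted system lies on the hyperplane ineq₀ ∙ y = 0; pushing it
  -- slightly along ineq₀ makes that inequality strict without breaking the others.
  alternative-promoted : (σ : System ℓ 0 (ℕ.suc q)) → ineq? σ zero ≡ true → ∀ y →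
                         Solution (promoteInequality σ) y → Alternative σ
  alternative-promoted σ on y (eqs , ineqs) with nonzero-coordinate (ineq σ zero)
  ... | inj₁ s₀≡0 = inj₂ ((λ ()) , 1# ∷ (λ _ → 0#) , dep , (λ ()) , off , λⁱ≥0 , (zero , 0<1))
    where
    dep : ∀ t → 0# + (1# * ineq σ zero t + ∑ ℝ (λ j → 0# * tail (ineq σ) j t)) ≡ 0#
    dep t = begin
      0# + (1# * ineq σ zero t + ∑ ℝ (λ j → 0# * tail (ineq σ) j t))
        ≡⟨ +-identityˡ _ ⟩
      1# * ineq σ zero t + ∑ ℝ (λ j → 0# * tail (ineq σ) j t)
        ≡⟨ cong₂ _+_ (trans (cong (1# *_) (s₀≡0 t)) (zeroʳ 1#)) (∑-zero _ (λ j → zeroˡ (tail (ineq σ) j t))) ⟩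
      0# + 0#
        ≡⟨ +-identityˡ 0# ⟩
      0# ∎
    off : ∀ j → ineq? σ j ≡ false → (1# ∷ (λ _ → 0#)) j ≡ 0#
    off zero off₀ = ⊥-elim (true≢false (trans (sym on) off₀))
    off (suc j) _ = refl
    λⁱ≥0 : ∀ j → 0# ≤ᵣ (1# ∷ (λ _ → 0#)) j
    λⁱ≥0 zero = inj₁ 0<1
    λⁱ≥0 (suc j) = inj₂ refl
  ... | inj₂ (t , s₀t≢0) with perturbations (tail (ineq? σ)) (λ j → tail (ineq σ) j ∙ y)
                                             (λ j → tail (ineq σ) j ∙ ineq σ zero) ineqs
  ...   | ε , 0<ε , ε-ok = inj₁ (y +ᵥ ε *ᵥ s₀ , (λ ()) , ineqs′)
    where
    s₀ = ineq σ zero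
    ∙-perturbed : ∀ u → u ∙ (y +ᵥ ε *ᵥ s₀) ≡ u ∙ y + ε * u ∙ s₀
    ∙-perturbed u = trans (∙-distribʳ-+ᵥ u y (ε *ᵥ s₀)) (cong (u ∙ y +_) (∙-*ᵥʳ u s₀ ε))
    ineqs′ : ∀ j → ineq? σ j ≡ true → 0# < ineq σ j ∙ (y +ᵥ ε *ᵥ s₀)
    ineqs′ zero _ = subst (0# <_) (sym (trans (∙-perturbed s₀) (trans (cong (_+ ε * s₀ ∙ s₀) (eqs zero refl)) (+-identityˡ _))))
                      (*-pos 0<ε (∙-self-pos s₀ t s₀t≢0))
    ineqs′ (suc j) mj = subst (0# <_) (sym (∙-perturbed (ineq σ (suc j)))) (ε-ok j mj)

  alternative-dropInequality : (σ : System ℓ 0 (ℕ.suc q)) → Alternative (dropInequality σ) →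
                               Alternative (promoteInequality σ) → Alternative σ
  alternative-dropInequality σ (inj₂ (λᵉ , λⁱ , dep , offᵉ , offⁱ , λⁱ≥0 , (j , λⁱj>0))) _ =
    inj₂ (λᵉ , 0# ∷ λⁱ , dep′ , offᵉ , offⁱ′ , λⁱ′≥0 , (suc j , λⁱj>0))
    where
    dep′ : ∀ t → lincomb λᵉ (eq σ) t + (0# * ineq σ zero t + lincomb λⁱ (tail (ineq σ)) t) ≡ 0#
    dep′ t = trans (cong (lincomb λᵉ (eq σ) t +_) (trans (cong (_+ lincomb λⁱ (tail (ineq σ)) t) (zeroˡ _)) (+-identityˡ _))) (dep t)
    offⁱ′ : ∀ j → ineq? σ j ≡ false → (0# ∷ λⁱ) j ≡ 0#
    offⁱ′ zero _ = refl
    offⁱ′ (suc j) = offⁱ j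
    λⁱ′≥0 : ∀ j → 0# ≤ᵣ (0# ∷ λⁱ) j
    λⁱ′≥0 zero = inj₂ refl
    λⁱ′≥0 (suc j) = λⁱ≥0 j
  alternative-dropInequality σ (inj₁ (x , eqs , ineqs)) promoted with ineq? σ zero in on
  ... | false = inj₁ (x , eqs , λ { zero on′ → ⊥-elim (true≢false (trans (sym on′) on)) ; (suc j) → ineqs j })
  ... | true with compare 0# (ineq σ zero ∙ x) | promoted
  ...   | tri< 0<s₀x _ _ | _ = inj₁ (x , eqs , λ { zero _ → 0<s₀x ; (suc j) → ineqs j })
  ...   | tri≈ _ 0≡s₀x _ | inj₂ cert = inj₂ (certificate-promoted σ on x (eqs , ineqs) (inj₂ (sym 0≡s₀x)) cert)
  ...   | tri> _ _ s₀x<0 | inj₂ cert = inj₂ (certificate-promoted σ on x (eqs , ineqs) (inj₁ s₀x<0) cert)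
  ...   | tri≈ _ _ _ | inj₁ (y , sol) = alternative-promoted σ on y sol
  ...   | tri> _ _ _ | inj₁ (y , sol) = alternative-promoted σ on y sol

  alternative-firstEquation : (σ : System ℓ (ℕ.suc p) q) → Alternative (dropEquation σ) →
                              (∀ t (b₀t≢0 : eq σ zero t ≢ 0#) → Alternative (eliminate σ t b₀t≢0)) → Alternative σ
  alternative-firstEquation σ dropped eliminated with eq? σ zero in on | nonzero-coordinate (eq σ zero)
  ... | false | _ = alternative-dropEquation σ (inj₁ on) dropped
  ... | true | inj₁ b₀≡0 = alternative-dropEquation σ (inj₂ b₀≡0) dropped
  ... | true | inj₂ (t , b₀t≢0) = alternative-eliminate σ on t b₀t≢0 (eliminated t b₀t≢0)

  motzkin : ∀ q p (σ : System ℓ p q) → Alternative σ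
  motzkin ℕ.zero p σ = inj₁ (0ᵥ , (λ i _ → trans (∙-comm (eq σ i) 0ᵥ) (∙-zeroˡ (eq σ i) (λ _ → refl))) , λ ())
  motzkin (ℕ.suc q) (ℕ.suc p) σ =
    alternative-firstEquation σ (motzkin (ℕ.suc q) p (dropEquation σ)) (λ t b₀t≢0 → motzkin (ℕ.suc q) p (eliminate σ t b₀t≢0))
  motzkin (ℕ.suc q) ℕ.zero σ =
    alternative-dropInequality σ (motzkin q 0 (dropInequality σ)) (motzkin q 1 (promoteInequality σ))

module Subsets where

  open import Data.Bool using (true; false)
  open import Data.Empty using (⊥-elim)
  open import Data.Fin using (Fin)
  open import Data.Fin.Subset using (Subset; _∈_; _∉_; _⊆_; _∪_; _─_; _-_; inside; outside)
  open import Data.Fin.Subset.Properties using (p─q⊆p; x∈⁅x⁆; ⊆-antisym; x∈p∪q⁻; x∈p∪q⁺; x∈p∧x≢y⇒x∈p-y)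
  open import Data.Product using (_×_; _,_)
  open import Data.Sum using (inj₁; inj₂)
  open import Data.Nat using (ℕ)
  open import Data.Vec using (_∷_; here; there; lookup; tabulate)
  open import Data.Vec.Properties using ([]=⇒lookup; lookup⇒[]=; lookup∘tabulate)
  open import Relation.Binary.PropositionalEquality
  open import Relation.Nullary using (does; yes; no)
  open import Relation.Nullary.Decidable using (dec-true)
  open import Relation.Unary using (Pred; Decidable)

  private
    variable
      n : ℕ

  ∈⇒lookup : ∀ {i : Fin n} {S} → i ∈ S → lookup S i ≡ true
  ∈⇒lookup = []=⇒lookup

  lookup⇒∈ : ∀ {i : Fin n} {S} → lookup S i ≡ true → i ∈ S
  lookup⇒∈ {i = i} {S} = lookup⇒[]= i S

  ∉⇒lookup : ∀ {i : Fin n} {S} → i ∉ S → lookup S i ≡ false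
  ∉⇒lookup {i = i} {S} i∉S with lookup S i in Si
  ... | true = ⊥-elim (i∉S (lookup⇒∈ Si))
  ... | false = refl

  decSubset : ∀ {p} {P : Pred (Fin n) p} → Decidable P → Subset n
  decSubset P? = tabulate (λ i → does (P? i))

  ∈-decSubset⁺ : ∀ {p} {P : Pred (Fin n) p} (P? : Decidable P) {i} → P i → i ∈ decSubset P?
  ∈-decSubset⁺ P? {i} Pi = lookup⇒∈ (trans (lookup∘tabulate _ i) (dec-true (P? i) Pi))

  ∈-decSubset⁻ : ∀ {p} {P : Pred (Fin n) p} (P? : Decidable P) {i} → i ∈ decSubset P? → P i
  ∈-decSubset⁻ P? {i} i∈ with P? i | trans (sym (lookup∘tabulate (λ i → does (P? i)) i)) (∈⇒lookup i∈)
  ... | yes Pi | _ = Pi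
  ... | no _ | ()

  x∈p─q⁻ : ∀ {p q : Subset n} {x} → x ∈ p ─ q → x ∈ p × x ∉ q
  x∈p─q⁻ {p = p} {q} x∈ = p─q⊆p p q x∈ , ∉q x∈
    where
    ∉q : ∀ {n} {p q : Subset n} {x} → x ∈ p ─ q → x ∉ q
    ∉q {p = inside ∷ p} {outside ∷ q} here = λ ()
    ∉q {p = _ ∷ p} {_ ∷ q} (there x∈) (there x∈q) = ∉q x∈ x∈q

  x∈p-y⁻ : ∀ {p : Subset n} {x y} → x ∈ p - y → x ∈ p × x ≢ y
  x∈p-y⁻ {y = y} x∈ with x∈p─q⁻ x∈
  ... | x∈p , x∉⁅y⁆ = x∈p , λ { refl → x∉⁅y⁆ (x∈⁅x⁆ y) }

  ∪-remove : ∀ {U V : Subset n} {m} → m ∉ U → (U ∪ V) - m ≡ U ∪ (V - m)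
  ∪-remove {U = U} {V} {m} m∉U = ⊆-antisym into onto
    where
    into : (U ∪ V) - m ⊆ U ∪ (V - m)
    into i∈ with x∈p-y⁻ i∈
    ... | i∈U∪V , i≢m with x∈p∪q⁻ U V i∈U∪V
    ...   | inj₁ i∈U = x∈p∪q⁺ (inj₁ i∈U)
    ...   | inj₂ i∈V = x∈p∪q⁺ (inj₂ (x∈p∧x≢y⇒x∈p-y i∈V i≢m))
    onto : U ∪ (V - m) ⊆ (U ∪ V) - m
    onto i∈ with x∈p∪q⁻ U (V - m) i∈
    ... | inj₁ i∈U = x∈p∧x≢y⇒x∈p-y (x∈p∪q⁺ (inj₁ i∈U)) (λ { refl → m∉U i∈U })
    ... | inj₂ i∈V-m = let (i∈V , i≢m) = x∈p-y⁻ i∈V-m in x∈p∧x≢y⇒x∈p-y (x∈p∪q⁺ (inj₂ i∈V)) i≢m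

module Circuits (ℝ : RealField) {ℓ n : ℕ} (v : Fin n → Point ℝ ℓ) where

  open RealField ℝ
  open OrderedField ℝ
  open LinearAlgebra ℝ
  open Subsets
  open import Data.Empty using (⊥-elim)
  open import Data.Fin using (zero; suc)
  open import Data.Fin.Properties using (any?)
  open import Data.Fin.Subset using (Subset; _∈_; _∉_; _⊆_; _⊂_; _∩_; _∪_; Nonempty; ∣_∣)
  open import Data.Fin.Subset.Properties
    using (_∈?_; x∈p∩q⁺; x∈p∩q⁻; x∈p∪q⁺; x∈p∪q⁻; ⊆-antisym; p⊂q⇒∣p∣<∣q∣; x∈p⇒∣p-x∣<∣p∣)
  import Data.Nat as ℕ
  import Data.Nat.Properties as ℕ
  open import Data.Product using (∃; _×_; _,_; proj₁; proj₂)
  open import Data.Sum using (inj₁; inj₂)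
  open import Relation.Binary.Definitions using (tri<; tri≈; tri>)
  open import Relation.Binary.PropositionalEquality
  open import Relation.Nullary using (¬_; yes; no; ¬?)
  open import Relation.Nullary.Decidable using (_×-dec_; decidable-stable)
  open import Relation.Unary using (Pred; Decidable)
  open ≡-Reasoning

  IsDependency : (Fin n → Carrier) → Set
  IsDependency μ = ∀ t → lincomb μ v t ≡ 0#

  dependency-+* : ∀ {λ₁ μ} → IsDependency λ₁ → IsDependency μ → ∀ c → IsDependency (λ i → λ₁ i + c * μ i)
  dependency-+* {λ₁} {μ} dep-λ dep-μ c t = begin
    ∑ ℝ (λ i → (λ₁ i + c * μ i) * v i t)
      ≡⟨ ∑-cong (λ i → solve 4 (λ a c b x → (a :+ c :* b) :* x := a :* x :+ c :* (b :* x)) refl (λ₁ i) c (μ i) (v i t)) ⟩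
    ∑ ℝ (λ i → λ₁ i * v i t + c * (μ i * v i t))
      ≡⟨ ∑-distrib-+ (λ i → λ₁ i * v i t) (λ i → c * (μ i * v i t)) ⟩
    lincomb λ₁ v t + ∑ ℝ (λ i → c * (μ i * v i t))
      ≡⟨ cong₂ _+_ (dep-λ t) (trans (∑-*ˡ c (λ i → μ i * v i t)) (trans (cong (c *_) (dep-μ t)) (zeroʳ c))) ⟩
    0# + 0#
      ≡⟨ +-identityˡ 0# ⟩
    0# ∎

  support : (Fin n → Carrier) → Subset n
  support μ = decSubset (λ i → ¬? (μ i ≟ 0#))

  positivePart negativePart : (Fin n → Carrier) → Subset n
  positivePart μ = decSubset (λ i → 0# <? μ i)
  negativePart μ = decSubset (λ i → μ i <? 0#)

  ∈-support⁺ : ∀ {μ i} → μ i ≢ 0# → i ∈ support μ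
  ∈-support⁺ {μ} = ∈-decSubset⁺ (λ i → ¬? (μ i ≟ 0#))

  ∈-support⁻ : ∀ {μ i} → i ∈ support μ → μ i ≢ 0#
  ∈-support⁻ {μ} = ∈-decSubset⁻ (λ i → ¬? (μ i ≟ 0#))

  support-≡0 : ∀ {μ i} → i ∉ support μ → μ i ≡ 0#
  support-≡0 {μ} {i} i∉ with μ i ≟ 0#
  ... | yes μi≡0 = μi≡0
  ... | no μi≢0 = ⊥-elim (i∉ (∈-support⁺ μi≢0))

  signPattern-support : ∀ μ → positivePart μ ∪ negativePart μ ≡ support μ
  signPattern-support μ = ⊆-antisym into onto
    where
    into : positivePart μ ∪ negativePart μ ⊆ support μ
    into i∈ with x∈p∪q⁻ (positivePart μ) (negativePart μ) i∈
    ... | inj₁ i∈⁺ = ∈-support⁺ (>⇒≢ (∈-decSubset⁻ (λ i → 0# <? μ i) i∈⁺))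
    ... | inj₂ i∈⁻ = ∈-support⁺ (<⇒≢ (∈-decSubset⁻ (λ i → μ i <? 0#) i∈⁻))
    onto : support μ ⊆ positivePart μ ∪ negativePart μ
    onto {i} i∈ with compare (μ i) 0#
    ... | tri< μi<0 _ _ = x∈p∪q⁺ (inj₂ (∈-decSubset⁺ (λ i → μ i <? 0#) μi<0))
    ... | tri≈ _ μi≡0 _ = ⊥-elim (∈-support⁻ i∈ μi≡0)
    ... | tri> _ _ 0<μi = x∈p∪q⁺ (inj₁ (∈-decSubset⁺ (λ i → 0# <? μ i) 0<μi))

  signPattern-dependency : ∀ {μ} → IsDependency μ → SignedDependency ℝ v (positivePart μ) (negativePart μ)
  signPattern-dependency {μ} dep =
    μ , dep , (λ i → ∈-decSubset⁻ (λ i → 0# <? μ i)) , (λ i → ∈-decSubset⁺ (λ i → 0# <? μ i))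
            , (λ i → ∈-decSubset⁻ (λ i → μ i <? 0#)) , (λ i → ∈-decSubset⁺ (λ i → μ i <? 0#))

  signedDependency-support : ∀ {D⁺ D⁻} (dep : SignedDependency ℝ v D⁺ D⁻) → D⁺ ∪ D⁻ ≡ support (proj₁ dep)
  signedDependency-support {D⁺} {D⁻} (μ , _ , ∈⁺ , ⁺∈ , ∈⁻ , ⁻∈) = ⊆-antisym into onto
    where
    into : D⁺ ∪ D⁻ ⊆ support μ
    into {i} i∈ with x∈p∪q⁻ D⁺ D⁻ i∈
    ... | inj₁ i∈⁺ = ∈-support⁺ (>⇒≢ (∈⁺ i i∈⁺))
    ... | inj₂ i∈⁻ = ∈-support⁺ (<⇒≢ (∈⁻ i i∈⁻))
    onto : support μ ⊆ D⁺ ∪ D⁻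
    onto {i} i∈ with compare (μ i) 0#
    ... | tri< μi<0 _ _ = x∈p∪q⁺ (inj₂ (⁻∈ i μi<0))
    ... | tri≈ _ μi≡0 _ = ⊥-elim (∈-support⁻ i∈ μi≡0)
    ... | tri> _ _ 0<μi = x∈p∪q⁺ (inj₁ (⁺∈ i 0<μi))

  support-+* : ∀ {λ₁ μ} c → support μ ⊆ support λ₁ → support (λ i → λ₁ i + c * μ i) ⊆ support λ₁
  support-+* {λ₁} {μ} c μ⊆λ {i} i∈ with i ∈? support λ₁
  ... | yes i∈λ = i∈λ
  ... | no i∉λ = ⊥-elim (∈-support⁻ i∈ (begin
    λ₁ i + c * μ i   ≡⟨ cong₂ (λ a b → a + c * b) (support-≡0 i∉λ) (support-≡0 (λ i∈μ → i∉λ (μ⊆λ i∈μ))) ⟩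
    0# + c * 0#      ≡⟨ trans (+-identityˡ _) (zeroʳ c) ⟩
    0#               ∎))

  minimal-support⇒circuit : ∀ {λ₁} → IsDependency λ₁ → Nonempty (positivePart λ₁ ∪ negativePart λ₁) →
                            (∀ μ → IsDependency μ → support μ ⊂ support λ₁ → ¬ Nonempty (support μ)) →
                            SignedCircuit ℝ v (positivePart λ₁) (negativePart λ₁)
  minimal-support⇒circuit {λ₁} dep λ₁≢0 minimal = signPattern-dependency dep , λ₁≢0 , is-minimal
    where
    is-minimal : ∀ D⁺ D⁻ → SignedDependency ℝ v D⁺ D⁻ → Nonempty (D⁺ ∪ D⁻) →
                 D⁺ ∪ D⁻ ⊆ positivePart λ₁ ∪ negativePart λ₁ → positivePart λ₁ ∪ negativePart λ₁ ⊆ D⁺ ∪ D⁻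
    is-minimal D⁺ D⁻ D@(μ , dep-μ , _) D≢0 D⊆C {i} i∈C with μ i ≟ 0#
    ... | no μi≢0 = subst (i ∈_) (sym (signedDependency-support D)) (∈-support⁺ μi≢0)
    ... | yes μi≡0 = ⊥-elim (minimal μ dep-μ (μ⊆λ , i , subst (i ∈_) (signPattern-support λ₁) i∈C ,
                                                 λ i∈μ → ∈-support⁻ i∈μ μi≡0)
                                      (subst Nonempty (signedDependency-support D) D≢0))
      where
      μ⊆λ : support μ ⊆ support λ₁
      μ⊆λ {j} j∈ = subst (j ∈_) (signPattern-support λ₁) (D⊆C (subst (j ∈_) (sym (signedDependency-support D)) j∈))

  dependency-* : ∀ {μ} → IsDependency μ → ∀ c → IsDependency (λ i → c * μ i)
  dependency-* {μ} dep c t = begin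
    ∑ ℝ (λ i → c * μ i * v i t)   ≡⟨ ∑-cong (λ i → solve 3 (λ c m x → c :* m :* x := c :* (m :* x)) refl c (μ i) (v i t)) ⟩
    ∑ ℝ (λ i → c * (μ i * v i t)) ≡⟨ ∑-*ˡ c (λ i → μ i * v i t) ⟩
    c * lincomb μ v t             ≡⟨ cong (c *_) (dep t) ⟩
    c * 0#                        ≡⟨ zeroʳ c ⟩
    0#                            ∎

  support-neg : ∀ μ → support (λ i → - 1# * μ i) ≡ support μ
  support-neg μ = ⊆-antisym (λ i∈ → ∈-support⁺ (λ μi≡0 → ∈-support⁻ i∈ (-1*x≡0 μi≡0)))
                            (λ i∈ → ∈-support⁺ (λ -μi≡0 → ∈-support⁻ i∈ (x≡0 -μi≡0)))
    where
    -1*x≡0 : ∀ {x} → x ≡ 0# → - 1# * x ≡ 0#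
    -1*x≡0 refl = zeroʳ (- 1#)
    x≡0 : ∀ {x} → - 1# * x ≡ 0# → x ≡ 0#
    x≡0 {x} -x≡0 = begin
      x               ≡⟨ sym (-‿involutive x) ⟩
      - (- x)         ≡⟨ cong -_ (trans (sym (-1*x≈-x x)) -x≡0) ⟩
      - 0#            ≡⟨ -0#≈0# ⟩
      0#              ∎

  argmin : ∀ {k p} {P : Pred (Fin k) p} → Decidable P → (f : Fin k → Carrier) → ∃ P →
           ∃ λ j → P j × (∀ i → P i → f j ≤ᵣ f i)
  argmin {ℕ.suc k} P? f ∃P with any? (λ i → P? (suc i))
  ... | no ¬∃P′ = zero , P₀ ∃P , λ { zero _ → inj₂ refl ; (suc i) Pi → ⊥-elim (¬∃P′ (i , Pi)) }
    where
    P₀ : ∃ _ → _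
    P₀ (zero , P0) = P0
    P₀ (suc i , Pi) = ⊥-elim (¬∃P′ (i , Pi))
  ... | yes ∃P′ with argmin (λ i → P? (suc i)) (λ i → f (suc i)) ∃P′ | P? zero
  ...   | j , Pj , min | no ¬P₀ = suc j , Pj , λ { zero P₀ → ⊥-elim (¬P₀ P₀) ; (suc i) → min i }
  ...   | j , Pj , min | yes P₀ with f (suc j) <? f zero
  ...     | yes fj<f₀ = suc j , Pj , λ { zero _ → inj₁ fj<f₀ ; (suc i) → min i }
  ...     | no fj≮f₀ = zero , P₀ , λ { zero _ → inj₂ refl ; (suc i) Pi → ≤-trans (≮⇒≥ fj≮f₀) (min i Pi) }

  module _ (W N : Subset n) where

    record PositiveDependency (μ : Fin n → Carrier) : Set where
      field
        dependency : IsDependency μ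
        outside    : ∀ i → i ∉ N → i ∉ W → μ i ≡ 0#
        nonNeg     : ∀ i → i ∈ W → 0# ≤ᵣ μ i
        witness    : Fin n
        witness∈W  : witness ∈ W
        witness>0  : 0# < μ witness

    record PositiveCircuit (C⁺ C⁻ : Subset n) : Set where
      field
        circuit    : SignedCircuit ℝ v C⁺ C⁻
        meets-W    : Nonempty (W ∩ C⁺)
        W-positive : W ∩ C⁺ ≡ W ∩ (C⁺ ∪ C⁻)
        positive⊆  : ∀ i → i ∈ C⁺ → i ∉ W → i ∈ N
        negative⊆  : C⁻ ⊆ N

    private
      outside-+* : ∀ {λ₁ μ} → support μ ⊆ support λ₁ → (∀ i → i ∉ N → i ∉ W → λ₁ i ≡ 0#) →
                   ∀ c i → i ∉ N → i ∉ W → λ₁ i + c * μ i ≡ 0#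
      outside-+* {λ₁} μ⊆λ out c i i∉N i∉W =
        support-≡0 (λ i∈ → ∈-support⁻ (support-+* c μ⊆λ i∈) (out i i∉N i∉W))

    cancel-off-W : ∀ {λ₁ μ} → PositiveDependency λ₁ → IsDependency μ → support μ ⊆ support λ₁ →
                   (∀ j → j ∈ W → μ j ≡ 0#) → ∀ k → μ k ≢ 0# →
                   ∃ λ λ′ → PositiveDependency λ′ × support λ′ ⊂ support λ₁
    cancel-off-W {λ₁} {μ} P dep-μ μ⊆λ μ|W≡0 k μk≢0 =
      λ′ , P′ , support-+* c μ⊆λ , k , μ⊆λ (∈-support⁺ μk≢0) , (λ k∈ → ∈-support⁻ k∈ λ′k≡0)
      where
      open PositiveDependency P
      c = - (λ₁ k * μ k ⁻¹)
      λ′ = λ i → λ₁ i + c * μ i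
      λ′|W : ∀ j → j ∈ W → λ′ j ≡ λ₁ j
      λ′|W j j∈W = trans (cong (λ z → λ₁ j + c * z) (μ|W≡0 j j∈W)) (trans (cong (λ₁ j +_) (zeroʳ c)) (+-identityʳ _))
      λ′k≡0 : λ′ k ≡ 0#
      λ′k≡0 = begin
        λ₁ k + - (λ₁ k * μ k ⁻¹) * μ k
          ≡⟨ solve 3 (λ l w m → l :+ :- (l :* w) :* m := l :+ :- (l :* (m :* w))) refl (λ₁ k) (μ k ⁻¹) (μ k) ⟩
        λ₁ k + - (λ₁ k * (μ k * μ k ⁻¹)) ≡⟨ cong (λ z → λ₁ k + - (λ₁ k * z)) (*-inverseʳ (μ k) μk≢0) ⟩
        λ₁ k + - (λ₁ k * 1#)             ≡⟨ cong (λ z → λ₁ k + - z) (*-identityʳ (λ₁ k)) ⟩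
        λ₁ k + - λ₁ k                    ≡⟨ -‿inverseʳ (λ₁ k) ⟩
        0#                               ∎
      P′ : PositiveDependency λ′
      P′ = record
        { dependency = dependency-+* dependency dep-μ c
        ; outside    = outside-+* μ⊆λ outside c
        ; nonNeg     = λ j j∈W → subst (0# ≤ᵣ_) (sym (λ′|W j j∈W)) (nonNeg j j∈W)
        ; witness    = witness
        ; witness∈W  = witness∈W
        ; witness>0  = subst (0# <_) (sym (λ′|W witness witness∈W)) witness>0
        }

    ratio-test : ∀ {λ₁ μ} → PositiveDependency λ₁ → IsDependency μ → support μ ⊆ support λ₁ →
                 ∀ j₀ → j₀ ∈ W → 0# < μ j₀ → ∃ (λ j → j ∈ W × μ j < 0#) →
                 ∃ λ λ′ → PositiveDependency λ′ × support λ′ ⊂ support λ₁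
    ratio-test {λ₁} {μ} P dep-μ μ⊆λ j₀ j₀∈W 0<μj₀ ∃neg =
      λ′ , P′ , support-+* t μ⊆λ , k , μ⊆λ (∈-support⁺ (<⇒≢ μk<0)) , (λ k∈ → ∈-support⁻ k∈ λ′k≡0)
      where
      open PositiveDependency P
      ratio : Fin n → Carrier
      ratio j = λ₁ j * (- μ j) ⁻¹
      minimizer = argmin (λ j → (j ∈? W) ×-dec (μ j <? 0#)) ratio ∃neg
      k = proj₁ minimizer
      k∈W = proj₁ (proj₁ (proj₂ minimizer))
      μk<0 = proj₂ (proj₁ (proj₂ minimizer))
      minimal = proj₂ (proj₂ minimizer)
      t = ratio k
      λ′ = λ i → λ₁ i + t * μ i
      ratio-cancels : ∀ j → μ j < 0# → ratio j * μ j ≡ - λ₁ j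
      ratio-cancels j μj<0 = begin
        λ₁ j * (- μ j) ⁻¹ * μ j
          ≡⟨ solve 3 (λ l w m → l :* w :* m := :- (l :* ((:- m) :* w))) refl (λ₁ j) ((- μ j) ⁻¹) (μ j) ⟩
        - (λ₁ j * (- μ j * (- μ j) ⁻¹))      ≡⟨ cong (λ z → - (λ₁ j * z)) (*-inverseʳ (- μ j) (>⇒≢ (neg⇒pos μj<0))) ⟩
        - (λ₁ j * 1#)                        ≡⟨ cong -_ (*-identityʳ (λ₁ j)) ⟩
        - λ₁ j                               ∎
      0≤t : 0# ≤ᵣ t
      0≤t = nonNeg*nonNeg⇒nonNeg (nonNeg k k∈W) (inj₁ (⁻¹-pos (neg⇒pos μk<0)))
      λ′k≡0 : λ′ k ≡ 0#
      λ′k≡0 = trans (cong (λ₁ k +_) (ratio-cancels k μk<0)) (-‿inverseʳ (λ₁ k))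
      nonNeg′ : ∀ j → j ∈ W → 0# ≤ᵣ λ′ j
      nonNeg′ j j∈W with compare (μ j) 0#
      ... | tri< μj<0 _ _ = ≤-trans (inj₂ (sym (trans (cong (λ₁ j +_) (ratio-cancels j μj<0)) (-‿inverseʳ (λ₁ j)))))
                                    (+-monoʳ-≤ (λ₁ j) (*-monoˡ-≤-neg μj<0 (minimal j (j∈W , μj<0))))
      ... | tri≈ _ μj≡0 _ = nonNeg+nonNeg⇒nonNeg (nonNeg j j∈W) (nonNeg*nonNeg⇒nonNeg 0≤t (inj₂ (sym μj≡0)))
      ... | tri> _ _ 0<μj = nonNeg+nonNeg⇒nonNeg (nonNeg j j∈W) (nonNeg*nonNeg⇒nonNeg 0≤t (inj₁ 0<μj))
      P′ : PositiveDependency λ′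
      P′ = record
        { dependency = dependency-+* dependency dep-μ t
        ; outside    = outside-+* μ⊆λ outside t
        ; nonNeg     = nonNeg′
        ; witness    = j₀
        ; witness∈W  = j₀∈W
        ; witness>0  = pos+nonNeg⇒pos (≥∧≢⇒> (nonNeg j₀ j₀∈W) (∈-support⁻ (μ⊆λ (∈-support⁺ (>⇒≢ 0<μj₀)))))
                                      (nonNeg*nonNeg⇒nonNeg 0≤t (inj₁ 0<μj₀))
        }

    positive-somewhere : ∀ {λ₁ μ} → PositiveDependency λ₁ → IsDependency μ → support μ ⊂ support λ₁ →
                         ∀ j₀ → j₀ ∈ W → 0# < μ j₀ → ∃ λ λ′ → PositiveDependency λ′ × support λ′ ⊂ support λ₁
    positive-somewhere {λ₁} {μ} P dep-μ μ⊂λ j₀ j₀∈W 0<μj₀ with any? (λ j → (j ∈? W) ×-dec (μ j <? 0#))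
    ... | yes ∃neg = ratio-test P dep-μ (proj₁ μ⊂λ) j₀ j₀∈W 0<μj₀ ∃neg
    ... | no ∄neg = μ , μ-positive , μ⊂λ
      where
      open PositiveDependency P
      μ-positive : PositiveDependency μ
      μ-positive = record
        { dependency = dep-μ
        ; outside    = λ i i∉N i∉W → support-≡0 (λ i∈ → ∈-support⁻ (proj₁ μ⊂λ i∈) (outside i i∉N i∉W))
        ; nonNeg     = λ j j∈W → ≮⇒≥ (λ μj<0 → ∄neg (j , j∈W , μj<0))
        ; witness    = j₀
        ; witness∈W  = j₀∈W
        ; witness>0  = 0<μj₀
        }

    -- Either λ₁ + c μ, with c cancelling a coordinate (by the ratio test when μ takes both
    -- signs on W), or ±μ itself is again positive and has a smaller support.
    shrink-positiveDependency : ∀ {λ₁ μ} → PositiveDependency λ₁ → IsDependency μ → support μ ⊂ support λ₁ →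
                                Nonempty (support μ) → ∃ λ λ′ → PositiveDependency λ′ × support λ′ ⊂ support λ₁
    shrink-positiveDependency {λ₁} {μ} P dep-μ μ⊂λ (k , k∈μ) with any? (λ j → (j ∈? W) ×-dec ¬? (μ j ≟ 0#))
    ... | no ∄ = cancel-off-W P dep-μ (proj₁ μ⊂λ)
                              (λ j j∈W → decidable-stable (μ j ≟ 0#) (λ μj≢0 → ∄ (j , j∈W , μj≢0)))
                              k (∈-support⁻ k∈μ)
    ... | yes (j₀ , j₀∈W , μj₀≢0) with compare (μ j₀) 0#
    ...   | tri> _ _ 0<μj₀ = positive-somewhere P dep-μ μ⊂λ j₀ j₀∈W 0<μj₀
    ...   | tri≈ _ μj₀≡0 _ = ⊥-elim (μj₀≢0 μj₀≡0)
    ...   | tri< μj₀<0 _ _ = positive-somewhere P (dependency-* dep-μ (- 1#)) (subst (_⊂ support λ₁) (sym (support-neg μ)) μ⊂λ)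
                                               j₀ j₀∈W (subst (0# <_) (sym (-1*x≈-x (μ j₀))) (neg⇒pos μj₀<0))

    positivePart-positiveCircuit : ∀ {λ₁} → PositiveDependency λ₁ → SignedCircuit ℝ v (positivePart λ₁) (negativePart λ₁) →
                                   PositiveCircuit (positivePart λ₁) (negativePart λ₁)
    positivePart-positiveCircuit {λ₁} P circuit = record
      { circuit    = circuit
      ; meets-W    = witness , x∈p∩q⁺ (witness∈W , ∈⁺ witness>0)
      ; W-positive = ⊆-antisym W⁺⊆W± W±⊆W⁺
      ; positive⊆  = λ i i∈C⁺ i∉W → decidable-stable (i ∈? N) (λ i∉N → >⇒≢ (⁺∈ i∈C⁺) (outside i i∉N i∉W))
      ; negative⊆  = λ {i} i∈C⁻ → decidable-stable (i ∈? N) (λ i∉N → negative-in-N i (⁻∈ i∈C⁻) i∉N)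
      }
      where
      open PositiveDependency P
      C⁺ = positivePart λ₁
      C⁻ = negativePart λ₁
      ∈⁺ : ∀ {i} → 0# < λ₁ i → i ∈ C⁺
      ∈⁺ = ∈-decSubset⁺ (λ i → 0# <? λ₁ i)
      ⁺∈ : ∀ {i} → i ∈ C⁺ → 0# < λ₁ i
      ⁺∈ = ∈-decSubset⁻ (λ i → 0# <? λ₁ i)
      ⁻∈ : ∀ {i} → i ∈ C⁻ → λ₁ i < 0#
      ⁻∈ = ∈-decSubset⁻ (λ i → λ₁ i <? 0#)
      negative-in-N : ∀ i → λ₁ i < 0# → ¬ i ∉ N
      negative-in-N i λi<0 i∉N with i ∈? W
      ... | yes i∈W = ≤⇒≯ (nonNeg i i∈W) λi<0
      ... | no i∉W = <⇒≢ λi<0 (outside i i∉N i∉W)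
      W⁺⊆W± : W ∩ C⁺ ⊆ W ∩ (C⁺ ∪ C⁻)
      W⁺⊆W± {i} i∈ = let (i∈W , i∈C⁺) = x∈p∩q⁻ W C⁺ i∈ in x∈p∩q⁺ (i∈W , x∈p∪q⁺ (inj₁ i∈C⁺))
      W±⊆W⁺ : W ∩ (C⁺ ∪ C⁻) ⊆ W ∩ C⁺
      W±⊆W⁺ {i} i∈ with x∈p∩q⁻ W (C⁺ ∪ C⁻) i∈
      ... | i∈W , i∈C with x∈p∪q⁻ C⁺ C⁻ i∈C
      ...   | inj₁ i∈C⁺ = x∈p∩q⁺ (i∈W , i∈C⁺)
      ...   | inj₂ i∈C⁻ = ⊥-elim (≤⇒≯ (nonNeg i i∈W) (⁻∈ i∈C⁻))

    no-positiveCircuit⇒no-positiveDependency : (∀ C⁺ C⁻ → ¬ PositiveCircuit C⁺ C⁻) → ∀ λ₁ → ¬ PositiveDependency λ₁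
    no-positiveCircuit⇒no-positiveDependency no-circuit λ₁ = go ∣ support λ₁ ∣ λ₁ ℕ.≤-refl
      where
      go : ∀ k λ₁ → ∣ support λ₁ ∣ ℕ.≤ k → ¬ PositiveDependency λ₁
      go ℕ.zero λ₁ bound P =
        ℕ.n≮0 (ℕ.<-≤-trans (x∈p⇒∣p-x∣<∣p∣ (∈-support⁺ (>⇒≢ (PositiveDependency.witness>0 P)))) bound)
      go (ℕ.suc k) λ₁ bound P = no-circuit _ _ (positivePart-positiveCircuit P circuit)
        where
        open PositiveDependency P
        not-smaller : ∀ μ → IsDependency μ → support μ ⊂ support λ₁ → ¬ Nonempty (support μ)
        not-smaller μ dep-μ μ⊂λ μ≢0 with shrink-positiveDependency P dep-μ μ⊂λ μ≢0
        ... | λ′ , P′ , λ′⊂λ = go k λ′ (ℕ.≤-pred (ℕ.≤-trans (p⊂q⇒∣p∣<∣q∣ λ′⊂λ) bound)) P′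
        circuit : SignedCircuit ℝ v (positivePart λ₁) (negativePart λ₁)
        circuit = minimal-support⇒circuit dependency
                    (witness , subst (witness ∈_) (sym (signPattern-support λ₁)) (∈-support⁺ (>⇒≢ witness>0)))
                    not-smaller

  signedCircuit-disjoint : ∀ {C⁺ C⁻} → SignedCircuit ℝ v C⁺ C⁻ → ∀ {x} → x ∈ C⁺ → x ∉ C⁻
  signedCircuit-disjoint ((μ , _ , ∈⁺ , _ , ∈⁻ , _) , _) x∈C⁺ x∈C⁻ = <-asym (∈⁺ _ x∈C⁺) (∈⁻ _ x∈C⁻)

module Monomials where

  open import Defs using (Mono; oneM; _*M_; _∣M_; varM; setM)
  open Subsets
  open import Data.Bool using (if_then_else_)
  open import Data.Empty using (⊥-elim)
  open import Data.Fin as Fin using (Fin)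
  open import Data.Fin.Subset using (Subset; _∈_; _∉_; _⊆_; _∪_; _-_)
  open import Data.Fin.Subset.Properties using (_∈?_; x∈p∪q⁻; x∈p∪q⁺; x∈p∧x≢y⇒x∈p-y)
  open import Data.Nat as ℕ using (ℕ; _+_; _≤_; _∸_)
  import Data.Nat.Properties as ℕ
  open import Data.Product using (∃; _×_; _,_; proj₁; proj₂)
  open import Data.Sum using (inj₁; inj₂; [_,_]′)
  open import Function using (_∘_)
  open import Data.Vec using (lookup; zipWith)
  open import Data.Vec.Properties using (lookup-zipWith; lookup-replicate; lookup∘tabulate; lookup-map; tabulate∘lookup; tabulate-cong)
  open import Data.Vec.Relation.Binary.Pointwise.Inductive as Pointwise using (Pointwise)
  open import Relation.Binary.PropositionalEquality
  open import Relation.Nullary using (yes; no)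
  open import Relation.Nullary.Decidable using (dec-true; dec-false; decidable-stable)
  open import Data.Fin.Properties using (any?)

  private
    variable
      n k : ℕ

  lookup-*M : ∀ (a b : Mono n) i → lookup (a *M b) i ≡ lookup a i + lookup b i
  lookup-*M a b i = lookup-zipWith _+_ i a b

  lookup-oneM : ∀ (i : Fin n) → lookup (oneM {n}) i ≡ 0
  lookup-oneM i = lookup-replicate i 0

  lookup-varM-≡ : ∀ (i : Fin n) → lookup (varM i) i ≡ 1
  lookup-varM-≡ i = trans (lookup∘tabulate _ i) (cong (λ b → if b then 1 else 0) (dec-true (i Fin.≟ i) refl))

  lookup-varM-≢ : ∀ {i j : Fin n} → i ≢ j → lookup (varM i) j ≡ 0
  lookup-varM-≢ {i = i} {j} i≢j = trans (lookup∘tabulate _ j) (cong (λ b → if b then 1 else 0) (dec-false (i Fin.≟ j) i≢j))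

  lookup-setM-∈ : ∀ {S : Subset n} {i} → i ∈ S → lookup (setM S) i ≡ 1
  lookup-setM-∈ {S = S} {i} i∈S = trans (lookup-map i _ S) (cong (λ b → if b then 1 else 0) (∈⇒lookup i∈S))

  lookup-setM-∉ : ∀ {S : Subset n} {i} → i ∉ S → lookup (setM S) i ≡ 0
  lookup-setM-∉ {S = S} {i} i∉S = trans (lookup-map i _ S) (cong (λ b → if b then 1 else 0) (∉⇒lookup i∉S))

  Mono-ext : ∀ {a b : Mono n} → (∀ i → lookup a i ≡ lookup b i) → a ≡ b
  Mono-ext {a = a} {b} a≗b = trans (sym (tabulate∘lookup a)) (trans (tabulate-cong a≗b) (tabulate∘lookup b))

  ∣M⁺ : ∀ {a b : Mono n} → (∀ i → lookup a i ≤ lookup b i) → a ∣M b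
  ∣M⁺ {a = a} {b} a≤b = subst₂ (Pointwise _≤_) (tabulate∘lookup a) (tabulate∘lookup b) (Pointwise.tabulate⁺ a≤b)

  ∣M⁻ : ∀ {a b : Mono n} → a ∣M b → ∀ i → lookup a i ≤ lookup b i
  ∣M⁻ = Pointwise.lookup

  *M-comm : ∀ (a b : Mono n) → a *M b ≡ b *M a
  *M-comm a b = Mono-ext λ i → trans (lookup-*M a b i) (trans (ℕ.+-comm (lookup a i) _) (sym (lookup-*M b a i)))

  *M-identityˡ : ∀ (a : Mono n) → oneM *M a ≡ a
  *M-identityˡ a = Mono-ext λ i → trans (lookup-*M oneM a i) (cong (_+ lookup a i) (lookup-oneM i))

  *M-identityʳ : ∀ (a : Mono n) → a *M oneM ≡ a
  *M-identityʳ a = trans (*M-comm a oneM) (*M-identityˡ a)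

  *M-cancelˡ : ∀ (a : Mono n) {b c} → a *M b ≡ a *M c → b ≡ c
  *M-cancelˡ a {b} {c} ab≡ac = Mono-ext λ i → ℕ.+-cancelˡ-≡ (lookup a i) _ _
    (trans (sym (lookup-*M a b i)) (trans (cong (λ z → lookup z i) ab≡ac) (lookup-*M a c i)))

  ∣M-refl : ∀ (a : Mono n) → a ∣M a
  ∣M-refl a = ∣M⁺ λ _ → ℕ.≤-refl

  oneM-∣M : ∀ (a : Mono n) → oneM ∣M a
  oneM-∣M a = ∣M⁺ λ i → subst (_≤ lookup a i) (sym (lookup-oneM i)) ℕ.z≤n

  *M-mono-∣M : ∀ {a b u v : Mono n} → a ∣M u → b ∣M v → (a *M b) ∣M (u *M v)
  *M-mono-∣M {a = a} {b} {u} {v} a∣u b∣v = ∣M⁺ λ i →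
    subst₂ _≤_ (sym (lookup-*M a b i)) (sym (lookup-*M u v i)) (ℕ.+-mono-≤ (∣M⁻ a∣u i) (∣M⁻ b∣v i))

  ∣M⇒*M : ∀ {a b : Mono n} → a ∣M b → ∃ λ c → a *M c ≡ b
  ∣M⇒*M {a = a} {b} a∣b = zipWith _∸_ b a , Mono-ext λ i → begin
    lookup (a *M zipWith _∸_ b a) i ≡⟨ lookup-*M a _ i ⟩
    lookup a i + lookup (zipWith _∸_ b a) i ≡⟨ cong (lookup a i +_) (lookup-zipWith _∸_ i b a) ⟩
    lookup a i + (lookup b i ∸ lookup a i) ≡⟨ ℕ.m+[n∸m]≡n (∣M⁻ a∣b i) ⟩
    lookup b i ∎
    where open ≡-Reasoning

  setM-∪ : ∀ {X Y : Subset n} → (∀ {x} → x ∈ X → x ∉ Y) → setM (X ∪ Y) ≡ setM X *M setM Y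
  setM-∪ {X = X} {Y} disjoint = Mono-ext λ i → trans (coordinate i) (sym (lookup-*M (setM X) (setM Y) i))
    where
    coordinate : ∀ i → lookup (setM (X ∪ Y)) i ≡ lookup (setM X) i + lookup (setM Y) i
    coordinate i with i ∈? X | i ∈? Y
    ... | yes i∈X | _ = trans (lookup-setM-∈ {S = X ∪ Y} (x∈p∪q⁺ (inj₁ i∈X)))
                              (sym (cong₂ _+_ (lookup-setM-∈ i∈X) (lookup-setM-∉ (disjoint i∈X))))
    ... | no i∉X | yes i∈Y = trans (lookup-setM-∈ {S = X ∪ Y} (x∈p∪q⁺ (inj₂ i∈Y)))
                                   (sym (cong₂ _+_ (lookup-setM-∉ i∉X) (lookup-setM-∈ i∈Y)))
    ... | no i∉X | no i∉Y = trans (lookup-setM-∉ {S = X ∪ Y} (λ i∈ → [ i∉X , i∉Y ]′ (x∈p∪q⁻ X Y i∈)))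
                                  (sym (cong₂ _+_ (lookup-setM-∉ i∉X) (lookup-setM-∉ i∉Y)))

  setM-mono : ∀ {A B : Subset n} → A ⊆ B → setM A ∣M setM B
  setM-mono {A = A} {B} A⊆B = ∣M⁺ coordinate
    where
    coordinate : ∀ i → lookup (setM A) i ≤ lookup (setM B) i
    coordinate i with i ∈? A
    ... | yes i∈A = ℕ.≤-reflexive (trans (lookup-setM-∈ i∈A) (sym (lookup-setM-∈ (A⊆B i∈A))))
    ... | no i∉A = subst (_≤ _) (sym (lookup-setM-∉ i∉A)) ℕ.z≤n

  setM-*M-varM : ∀ {S : Subset n} {i} → i ∈ S → setM (S - i) *M varM i ≡ setM S
  setM-*M-varM {S = S} {i} i∈S = Mono-ext λ x → trans (lookup-*M (setM (S - i)) (varM i) x) (coordinate x)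
    where
    coordinate : ∀ x → lookup (setM (S - i)) x + lookup (varM i) x ≡ lookup (setM S) x
    coordinate x with x Fin.≟ i | x ∈? S
    ... | yes refl | _ = trans (cong₂ _+_ (lookup-setM-∉ {S = S - i} (λ i∈ → proj₂ (x∈p-y⁻ i∈) refl)) (lookup-varM-≡ i))
                               (sym (lookup-setM-∈ i∈S))
    ... | no x≢i | yes x∈S = trans (cong₂ _+_ (lookup-setM-∈ {S = S - i} (x∈p∧x≢y⇒x∈p-y x∈S x≢i))
                                              (lookup-varM-≢ (x≢i ∘ sym)))
                                   (sym (lookup-setM-∈ x∈S))
    ... | no x≢i | no x∉S = trans (cong₂ _+_ (lookup-setM-∉ {S = S - i} (x∉S ∘ proj₁ ∘ x∈p-y⁻))
                                             (lookup-varM-≢ (x≢i ∘ sym)))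
                                  (sym (lookup-setM-∉ x∉S))

  lookup-setM-remove : ∀ {S : Subset n} {j x} → x ≢ j → lookup (setM (S - j)) x ≡ lookup (setM S) x
  lookup-setM-remove {S = S} {j} {x} x≢j with x ∈? S
  ... | yes x∈S = trans (lookup-setM-∈ {S = S - j} (x∈p∧x≢y⇒x∈p-y x∈S x≢j)) (sym (lookup-setM-∈ x∈S))
  ... | no x∉S = trans (lookup-setM-∉ {S = S - j} (x∉S ∘ proj₁ ∘ x∈p-y⁻)) (sym (lookup-setM-∉ x∉S))

  lookup-setM-removed : ∀ {S : Subset n} j → lookup (setM (S - j)) j ≡ 0
  lookup-setM-removed {S = S} j = lookup-setM-∉ {S = S - j} (λ j∈ → proj₂ (x∈p-y⁻ j∈) refl)

  proper-∣M-setM : ∀ {C : Subset n} {z} → z ∣M setM C → z ≢ setM C → ∃ λ x → x ∈ C × z ∣M setM (C - x)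
  proper-∣M-setM {C = C} {z} z∣C z≢C with any? (λ x → lookup z x ℕ.<? lookup (setM C) x)
  ... | no ∄< = ⊥-elim (z≢C (Mono-ext λ x → ℕ.≤-antisym (∣M⁻ z∣C x) (ℕ.≮⇒≥ (λ z<C → ∄< (x , z<C)))))
  ... | yes (x , zx<Cx) = x , x∈C , ∣M⁺ coordinate
    where
    x∈C : x ∈ C
    x∈C = decidable-stable (x ∈? C) (λ x∉C → ℕ.n≮0 (subst (lookup z x ℕ.<_) (lookup-setM-∉ x∉C) zx<Cx))
    zx≡0 : lookup z x ≡ 0
    zx≡0 = ℕ.n<1⇒n≡0 (subst (lookup z x ℕ.<_) (lookup-setM-∈ x∈C) zx<Cx)
    coordinate : ∀ y → lookup z y ≤ lookup (setM (C - x)) y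
    coordinate y with y Fin.≟ x
    ... | yes refl = ℕ.≤-reflexive (trans zx≡0 (sym (lookup-setM-removed {S = C} x)))
    ... | no y≢x = subst (lookup z y ≤_) (sym (lookup-setM-remove {S = C} y≢x)) (∣M⁻ z∣C y)

  varM-∣M : ∀ {m : Mono n} i → 1 ≤ lookup m i → varM i ∣M m
  varM-∣M {m = m} i 1≤mi = ∣M⁺ coordinate
    where
    coordinate : ∀ x → lookup (varM i) x ≤ lookup m x
    coordinate x with i Fin.≟ x
    ... | yes refl = subst (_≤ lookup m i) (sym (lookup-varM-≡ i)) 1≤mi
    ... | no i≢x = subst (_≤ lookup m x) (sym (lookup-varM-≢ i≢x)) ℕ.z≤n

  varM²-∣M : ∀ {m : Mono n} i → 2 ≤ lookup m i → (varM i *M varM i) ∣M m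
  varM²-∣M {m = m} i 2≤mi = ∣M⁺ coordinate
    where
    coordinate : ∀ x → lookup (varM i *M varM i) x ≤ lookup m x
    coordinate x with i Fin.≟ x
    ... | yes refl = subst (_≤ lookup m i) (sym (trans (lookup-*M (varM i) (varM i) i)
                                                       (cong₂ _+_ (lookup-varM-≡ i) (lookup-varM-≡ i)))) 2≤mi
    ... | no i≢x = subst (_≤ lookup m x) (sym (trans (lookup-*M (varM i) (varM i) x)
                                                     (cong₂ _+_ (lookup-varM-≢ i≢x) (lookup-varM-≢ i≢x)))) ℕ.z≤n

module Polynomials where

  open import Defs using (Mono; _*M_; Poly; coeff; -P_; _*P_)
  open Monomials
  open import Data.Bool using (true; false; if_then_else_)
  open import Data.Empty using (⊥-elim)
  open import Data.Integer as ℤ using (ℤ)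
  import Data.Integer.Properties as ℤ
  open import Data.List using (List; []; _∷_; _++_)
  open import Data.List.Properties using (++-identityʳ)
  open import Data.List.Relation.Unary.All as All using (All; []; _∷_)
  import Data.List.Relation.Unary.All.Properties as All
  open import Data.Nat using (ℕ)
  open import Data.Product using (_,_; proj₂)
  open import Data.Vec.Properties using (≡-dec)
  import Data.Nat as ℕ
  open import Function using (_∘_)
  open import Relation.Binary.PropositionalEquality
  open import Relation.Nullary using (does; yes; no)
  open import Relation.Nullary.Decidable using (dec-true; dec-false)
  open ≡-Reasoning

  private
    variable
      n : ℕ

  AllTerms : (Mono n → Set) → Poly n → Set
  AllTerms P = All (P ∘ proj₂)

  coeff-∷-≡ : ∀ c (a : Mono n) p → coeff ((c , a) ∷ p) a ≡ c ℤ.+ coeff p a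
  coeff-∷-≡ c a p = cong (λ b → (if b then c else ℤ.0ℤ) ℤ.+ coeff p a) (dec-true (≡-dec ℕ._≟_ a a) refl)

  coeff-∷-≢ : ∀ c {a m : Mono n} p → a ≢ m → coeff ((c , a) ∷ p) m ≡ coeff p m
  coeff-∷-≢ c {a} {m} p a≢m =
    trans (cong (λ b → (if b then c else ℤ.0ℤ) ℤ.+ coeff p m) (dec-false (≡-dec ℕ._≟_ a m) a≢m)) (ℤ.+-identityˡ _)

  coeff-++ : ∀ (p q : Poly n) m → coeff (p ++ q) m ≡ coeff p m ℤ.+ coeff q m
  coeff-++ [] q m = sym (ℤ.+-identityˡ _)
  coeff-++ ((c , a) ∷ p) q m = trans (cong (λ z → c′ ℤ.+ z) (coeff-++ p q m)) (sym (ℤ.+-assoc c′ (coeff p m) _))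
    where c′ = if does (≡-dec ℕ._≟_ a m) then c else ℤ.0ℤ

  coeff--P : ∀ (p : Poly n) m → coeff (-P p) m ≡ ℤ.- coeff p m
  coeff--P [] m = refl
  coeff--P ((c , a) ∷ p) m with does (≡-dec ℕ._≟_ a m)
  ... | true = trans (cong (λ z → ℤ.- c ℤ.+ z) (coeff--P p m)) (sym (ℤ.neg-distrib-+ c (coeff p m)))
  ... | false = trans (cong (λ z → ℤ.0ℤ ℤ.+ z) (coeff--P p m)) (sym (ℤ.neg-distrib-+ ℤ.0ℤ (coeff p m)))

  coeff≢0⇒ : ∀ {P : Mono n → Set} {p} m → AllTerms P p → coeff p m ≢ ℤ.0ℤ → P m
  coeff≢0⇒ {p = []} m [] c≢0 = ⊥-elim (c≢0 refl)
  coeff≢0⇒ {p = (c , a) ∷ p} m (Pa ∷ Pp) c≢0 with ≡-dec ℕ._≟_ a m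
  ... | yes refl = Pa
  ... | no _ = coeff≢0⇒ m Pp (c≢0 ∘ trans (ℤ.+-identityˡ _))

  coeff-absent : ∀ {p : Poly n} m → AllTerms (_≢ m) p → coeff p m ≡ ℤ.0ℤ
  coeff-absent {p = p} m absent with coeff p m ℤ.≟ ℤ.0ℤ
  ... | yes c≡0 = c≡0
  ... | no c≢0 = ⊥-elim (coeff≢0⇒ m absent c≢0 refl)

  AllTerms--P : ∀ {P : Mono n → Set} {p} → AllTerms P p → AllTerms P (-P p)
  AllTerms--P [] = []
  AllTerms--P (Pa ∷ Pp) = Pa ∷ AllTerms--P Pp

  termTimes : ℤ → Mono n → Poly n → Poly n
  termTimes c a [] = []
  termTimes c a ((d , b) ∷ q) = (c ℤ.* d , a *M b) ∷ termTimes c a q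

  ∷-*P : ∀ c (a : Mono n) p q → ((c , a) ∷ p) *P q ≡ termTimes c a q ++ (p *P q)
  ∷-*P c a p q = cong (_++ (p *P q)) (trans (sym (++-identityʳ _)) (trans (term-*P q) (++-identityʳ _)))
    where
    term-*P : ∀ q → ((c , a) ∷ []) *P q ≡ termTimes c a q ++ []
    term-*P [] = refl
    term-*P ((d , b) ∷ q) = cong ((c ℤ.* d , a *M b) ∷_) (term-*P q)

  AllTerms-termTimes : ∀ {P R : Mono n → Set} c a {q} → (∀ b → P b → R (a *M b)) → AllTerms P q → AllTerms R (termTimes c a q)
  AllTerms-termTimes c a R-ab [] = []
  AllTerms-termTimes c a R-ab (Pb ∷ Pq) = R-ab _ Pb ∷ AllTerms-termTimes c a R-ab Pq

  AllTerms-*P : ∀ {P Q R : Mono n → Set} {p q} → (∀ a b → P a → Q b → R (a *M b)) →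
             AllTerms P p → AllTerms Q q → AllTerms R (p *P q)
  AllTerms-*P R-ab [] Qq = []
  AllTerms-*P {p = (c , a) ∷ p} {q} R-ab (Pa ∷ Pp) Qq = subst (AllTerms _) (sym (∷-*P c a p q))
    (All.++⁺ (AllTerms-termTimes c a (λ b → R-ab a b Pa) Qq) (AllTerms-*P R-ab Pp Qq))

  coeff-termTimes : ∀ c (a : Mono n) q b → coeff (termTimes c a q) (a *M b) ≡ c ℤ.* coeff q b
  coeff-termTimes c a [] b = sym (ℤ.*-zeroʳ c)
  coeff-termTimes c a ((d , b′) ∷ q) b with ≡-dec ℕ._≟_ b′ b
  ... | yes refl = trans (coeff-∷-≡ (c ℤ.* d) (a *M b′) (termTimes c a q))
                         (trans (cong (λ z → c ℤ.* d ℤ.+ z) (coeff-termTimes c a q b′)) (sym (ℤ.*-distribˡ-+ c d _)))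
  ... | no b′≢b = trans (coeff-∷-≢ (c ℤ.* d) (termTimes c a q) (b′≢b ∘ *M-cancelˡ a))
                        (trans (coeff-termTimes c a q b) (cong (c ℤ.*_) (sym (ℤ.+-identityˡ (coeff q b)))))

  coeff-*P : ∀ {P Q : Mono n → Set} {p q} u v → AllTerms P p → AllTerms Q q →
             (∀ a b → P a → Q b → a *M b ≡ u *M v → a ≡ u) →
             coeff (p *P q) (u *M v) ≡ coeff p u ℤ.* coeff q v
  coeff-*P u v [] Qq unique = refl
  coeff-*P {p = (c , a) ∷ p} {q} u v (Pa ∷ Pp) Qq unique with ≡-dec ℕ._≟_ a u
  ... | yes refl = begin
    coeff (((c , a) ∷ p) *P q) (a *M v)
      ≡⟨ cong (λ r → coeff r (a *M v)) (∷-*P c a p q) ⟩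
    coeff (termTimes c a q ++ (p *P q)) (a *M v)
      ≡⟨ coeff-++ (termTimes c a q) (p *P q) (a *M v) ⟩
    coeff (termTimes c a q) (a *M v) ℤ.+ coeff (p *P q) (a *M v)
      ≡⟨ cong₂ ℤ._+_ (coeff-termTimes c a q v) (coeff-*P a v Pp Qq unique) ⟩
    c ℤ.* coeff q v ℤ.+ coeff p a ℤ.* coeff q v
      ≡⟨ sym (ℤ.*-distribʳ-+ (coeff q v) c (coeff p a)) ⟩
    (c ℤ.+ coeff p a) ℤ.* coeff q v ∎
  ... | no a≢u = begin
    coeff (((c , a) ∷ p) *P q) (u *M v)
      ≡⟨ cong (λ r → coeff r (u *M v)) (∷-*P c a p q) ⟩
    coeff (termTimes c a q ++ (p *P q)) (u *M v)
      ≡⟨ coeff-++ (termTimes c a q) (p *P q) (u *M v) ⟩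
    coeff (termTimes c a q) (u *M v) ℤ.+ coeff (p *P q) (u *M v)
      ≡⟨ cong₂ ℤ._+_ (coeff-absent (u *M v) (AllTerms-termTimes c a (λ b Qb ab≡uv → a≢u (unique a b Pa Qb ab≡uv)) Qq))
                     (coeff-*P u v Pp Qq unique) ⟩
    ℤ.0ℤ ℤ.+ coeff p u ℤ.* coeff q v
      ≡⟨ ℤ.+-identityˡ _ ⟩
    coeff p u ℤ.* coeff q v
      ≡⟨ cong (ℤ._* coeff q v) (sym (ℤ.+-identityˡ (coeff p u))) ⟩
    (ℤ.0ℤ ℤ.+ coeff p u) ℤ.* coeff q v ∎

module Binomials where

  open import Defs using (Mono; oneM; _*M_; _∣M_; varM; setM; Poly; coeff; oneP; varP; _-P_; _*P_; ∏P; prodMinusOne)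
  open Monomials
  open Polynomials
  open Subsets
  open import Data.Bool using (true; false; if_then_else_)
  open import Data.Empty using (⊥-elim)
  open import Data.Fin as Fin using (Fin; zero; suc)
  import Data.Fin.Properties as Fin
  open import Data.Fin.Subset using (Subset; _∈_; _-_)
  open import Data.Fin.Subset.Properties using (_∈?_)
  open import Data.Integer as ℤ using (ℤ)
  import Data.Integer.Properties as ℤ
  open import Data.Product using (_,_)
  open import Relation.Nullary using (does; yes; no)
  open import Relation.Nullary.Decidable using (dec-true; dec-false)
  open import Data.List using ([]; _∷_)
  open import Data.List.Relation.Unary.All using ([]; _∷_)
  open import Data.Nat as ℕ using (ℕ; _+_)
  import Data.Nat.Properties as ℕ
  open import Data.Vec using (lookup)
  open import Function using (_∘_)
  open import Function.Definitions using (Injective)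
  open import Relation.Binary.PropositionalEquality
  open ≡-Reasoning

  private
    variable
      n k : ℕ

  SupportedAt : Fin n → Mono n → Set
  SupportedAt x a = ∀ y → x ≢ y → lookup a y ≡ 0

  factor : Subset n → Fin n → Poly n
  factor T j = if does (j ∈? T) then varP j -P oneP else oneP

  factorTop : Subset n → Fin n → Mono n
  factorTop T j = if does (j ∈? T) then varM j else oneM

  ∏M : (Fin k → Mono n) → Mono n
  ∏M {ℕ.zero} w = oneM
  ∏M {ℕ.suc k} w = w zero *M ∏M (w ∘ suc)

  ∏M-cong : ∀ {w w′ : Fin k → Mono n} → (∀ i → w i ≡ w′ i) → ∏M w ≡ ∏M w′
  ∏M-cong {ℕ.zero} _ = refl
  ∏M-cong {ℕ.suc k} w≡w′ = cong₂ _*M_ (w≡w′ zero) (∏M-cong (w≡w′ ∘ suc))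

  factor-supported : ∀ (T : Subset n) j → AllTerms (SupportedAt j) (factor T j)
  factor-supported T j with does (j ∈? T)
  ... | true = (λ _ → lookup-varM-≢) ∷ (λ y _ → lookup-oneM y) ∷ []
  ... | false = (λ y _ → lookup-oneM y) ∷ []

  factorTop-supported : ∀ (T : Subset n) j → SupportedAt j (factorTop T j)
  factorTop-supported T j with does (j ∈? T)
  ... | true = λ _ → lookup-varM-≢
  ... | false = λ y _ → lookup-oneM y

  factor-bounded : ∀ (T : Subset n) j → AllTerms (_∣M factorTop T j) (factor T j)
  factor-bounded T j with does (j ∈? T)
  ... | true = ∣M-refl (varM j) ∷ oneM-∣M (varM j) ∷ []
  ... | false = ∣M-refl oneM ∷ []

  oneM≢varM : ∀ (j : Fin n) → oneM ≢ varM j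
  oneM≢varM j 1≡j = ℕ.0≢1+n (trans (sym (lookup-oneM j)) (trans (cong (λ a → lookup a j) 1≡j) (lookup-varM-≡ j)))

  coeff-factor-top : ∀ (T : Subset n) j → coeff (factor T j) (factorTop T j) ≡ ℤ.1ℤ
  coeff-factor-top {n} T j with does (j ∈? T)
  ... | true = trans (coeff-∷-≡ ℤ.1ℤ (varM j) ((ℤ.-1ℤ , oneM) ∷ []))
                     (cong (λ z → ℤ.1ℤ ℤ.+ z) (coeff-∷-≢ ℤ.-1ℤ [] (oneM≢varM j)))
  ... | false = coeff-∷-≡ ℤ.1ℤ (oneM {n}) []

  coeff-factor-oneM : ∀ {T : Subset n} {j} → j ∈ T → coeff (factor T j) oneM ≡ ℤ.-1ℤ
  coeff-factor-oneM {n} {T} {j} j∈T with j ∈? T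
  ... | yes _ = trans (coeff-∷-≢ ℤ.1ℤ ((ℤ.-1ℤ , oneM) ∷ []) (oneM≢varM j ∘ sym)) (coeff-∷-≡ ℤ.-1ℤ (oneM {n}) [])
  ... | no j∉T = ⊥-elim (j∉T j∈T)

  separated : ∀ x {a b u v : Mono n} → SupportedAt x a → SupportedAt x u → lookup b x ≡ 0 → lookup v x ≡ 0 →
              a *M b ≡ u *M v → a ≡ u
  separated x {a} {b} {u} {v} a-at-x u-at-x bx≡0 vx≡0 ab≡uv = Mono-ext coordinate
    where
    coordinate : ∀ y → lookup a y ≡ lookup u y
    coordinate y with x Fin.≟ y
    ... | no x≢y = trans (a-at-x y x≢y) (sym (u-at-x y x≢y))
    ... | yes refl = begin
      lookup a x                ≡⟨ sym (ℕ.+-identityʳ _) ⟩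
      lookup a x + 0            ≡⟨ cong (lookup a x +_) (sym bx≡0) ⟩
      lookup a x + lookup b x   ≡⟨ sym (lookup-*M a b x) ⟩
      lookup (a *M b) x         ≡⟨ cong (λ m → lookup m x) ab≡uv ⟩
      lookup (u *M v) x         ≡⟨ lookup-*M u v x ⟩
      lookup u x + lookup v x   ≡⟨ cong (lookup u x +_) vx≡0 ⟩
      lookup u x + 0            ≡⟨ ℕ.+-identityʳ _ ⟩
      lookup u x                ∎

  coeff-*P-separated : ∀ x {F R : Poly n} {u v} → AllTerms (SupportedAt x) F → AllTerms (λ b → lookup b x ≡ 0) R →
                       SupportedAt x u → lookup v x ≡ 0 → coeff (F *P R) (u *M v) ≡ coeff F u ℤ.* coeff R v
  coeff-*P-separated x {u = u} {v} F-at-x R-off-x u-at-x vx≡0 =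
    coeff-*P u v F-at-x R-off-x (λ a b a-at-x bx≡0 → separated x a-at-x u-at-x bx≡0 vx≡0)

  lookup-∏M-∉ : ∀ {w : Fin k → Mono n} {g : Fin k → Fin n} → (∀ i → SupportedAt (g i) (w i)) →
                ∀ x → (∀ i → g i ≢ x) → lookup (∏M w) x ≡ 0
  lookup-∏M-∉ {ℕ.zero} _ x _ = lookup-oneM x
  lookup-∏M-∉ {ℕ.suc k} {w = w} w-at-g x g≢x =
    trans (lookup-*M (w zero) (∏M (w ∘ suc)) x)
          (cong₂ _+_ (w-at-g zero x (g≢x zero)) (lookup-∏M-∉ (w-at-g ∘ suc) x (g≢x ∘ suc)))

  lookup-∏M-∈ : ∀ {w : Fin k → Mono n} {g : Fin k → Fin n} → (∀ i → SupportedAt (g i) (w i)) → Injective _≡_ _≡_ g →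
                ∀ {i₀ x} → g i₀ ≡ x → lookup (∏M w) x ≡ lookup (w i₀) x
  lookup-∏M-∈ {ℕ.suc k} {w = w} {g} w-at-g g-inj {zero} {x} g₀≡x =
    trans (lookup-*M (w zero) (∏M (w ∘ suc)) x)
          (trans (cong (lookup (w zero) x +_) (lookup-∏M-∉ (w-at-g ∘ suc) x x-fresh)) (ℕ.+-identityʳ _))
    where
    x-fresh : ∀ i → g (suc i) ≢ x
    x-fresh i gi≡x = Fin.0≢1+n (g-inj (trans g₀≡x (sym gi≡x)))
  lookup-∏M-∈ {ℕ.suc k} {w = w} {g} w-at-g g-inj {suc i₀} {x} gi₀≡x =
    trans (lookup-*M (w zero) (∏M (w ∘ suc)) x)
          (cong₂ _+_ (w-at-g zero x (λ g₀≡x → Fin.0≢1+n (g-inj (trans g₀≡x (sym gi₀≡x)))))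
                     (lookup-∏M-∈ (w-at-g ∘ suc) (Fin.suc-injective ∘ g-inj) gi₀≡x))

  module _ (T : Subset n) where

    ∏-off : ∀ {k} (g : Fin k → Fin n) x → (∀ i → g i ≢ x) → AllTerms (λ b → lookup b x ≡ 0) (∏P (factor T ∘ g))
    ∏-off {ℕ.zero} g x _ = lookup-oneM x ∷ []
    ∏-off {ℕ.suc k} g x g≢x = AllTerms-*P combine (factor-supported T (g zero)) (∏-off (g ∘ suc) x (g≢x ∘ suc))
      where
      combine : ∀ a b → SupportedAt (g zero) a → lookup b x ≡ 0 → lookup (a *M b) x ≡ 0
      combine a b a-at-g₀ bx≡0 = trans (lookup-*M a b x) (cong₂ _+_ (a-at-g₀ x (g≢x zero)) bx≡0)

    ∏-bounded : ∀ {k} (g : Fin k → Fin n) → AllTerms (_∣M ∏M (factorTop T ∘ g)) (∏P (factor T ∘ g))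
    ∏-bounded {ℕ.zero} g = ∣M-refl oneM ∷ []
    ∏-bounded {ℕ.suc k} g = AllTerms-*P (λ _ _ → *M-mono-∣M) (factor-bounded T (g zero)) (∏-bounded (g ∘ suc))

    coeff-∏-top : ∀ {k} (g : Fin k → Fin n) → Injective _≡_ _≡_ g →
                  coeff (∏P (factor T ∘ g)) (∏M (factorTop T ∘ g)) ≡ ℤ.1ℤ
    coeff-∏-top {ℕ.zero} g _ = coeff-∷-≡ ℤ.1ℤ (oneM {n}) []
    coeff-∏-top {ℕ.suc k} g g-inj = begin
      coeff (factor T (g zero) *P ∏P (factor T ∘ g ∘ suc)) (factorTop T (g zero) *M ∏M (factorTop T ∘ g ∘ suc))
        ≡⟨ coeff-*P-separated (g zero) (factor-supported T (g zero)) (∏-off (g ∘ suc) (g zero) g₀-fresh)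
                              (factorTop-supported T (g zero))
                              (lookup-∏M-∉ (λ i → factorTop-supported T (g (suc i))) (g zero) g₀-fresh) ⟩
      coeff (factor T (g zero)) (factorTop T (g zero)) ℤ.* coeff (∏P (factor T ∘ g ∘ suc)) (∏M (factorTop T ∘ g ∘ suc))
        ≡⟨ cong₂ ℤ._*_ (coeff-factor-top T (g zero)) (coeff-∏-top (g ∘ suc) (Fin.suc-injective ∘ g-inj)) ⟩
      ℤ.1ℤ ∎
      where
      g₀-fresh : ∀ i → g (suc i) ≢ g zero
      g₀-fresh i = Fin.0≢1+n ∘ sym ∘ g-inj

    dropAt : Fin n → Fin n → Mono n
    dropAt j x = if does (j Fin.≟ x) then oneM else factorTop T x

    dropAt-supported : ∀ j x → SupportedAt x (dropAt j x)
    dropAt-supported j x with does (j Fin.≟ x)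
    ... | true = λ y _ → lookup-oneM y
    ... | false = factorTop-supported T x

    dropAt-≢ : ∀ {j x} → j ≢ x → dropAt j x ≡ factorTop T x
    dropAt-≢ {j} {x} j≢x = cong (λ b → if b then oneM else factorTop T x) (dec-false (j Fin.≟ x) j≢x)

    dropAt-≡ : ∀ j → dropAt j j ≡ oneM
    dropAt-≡ j = cong (λ b → if b then oneM else factorTop T j) (dec-true (j Fin.≟ j) refl)

    coeff-∏-drop : ∀ {k} (g : Fin k → Fin n) → Injective _≡_ _≡_ g → ∀ {i₀ j} → g i₀ ≡ j → j ∈ T →
                   coeff (∏P (factor T ∘ g)) (∏M (dropAt j ∘ g)) ≡ ℤ.-1ℤ
    coeff-∏-drop {ℕ.suc k} g g-inj {zero} {j} refl j∈T = begin
      coeff (factor T j *P ∏P (factor T ∘ g ∘ suc)) (dropAt j j *M ∏M (dropAt j ∘ g ∘ suc))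
        ≡⟨ cong₂ (λ u v → coeff (factor T j *P ∏P (factor T ∘ g ∘ suc)) (u *M v))
                 (dropAt-≡ j) (∏M-cong (λ i → dropAt-≢ (j-fresh i ∘ sym))) ⟩
      coeff (factor T j *P ∏P (factor T ∘ g ∘ suc)) (oneM *M ∏M (factorTop T ∘ g ∘ suc))
        ≡⟨ coeff-*P-separated j (factor-supported T j) (∏-off (g ∘ suc) j j-fresh) (λ y _ → lookup-oneM y)
                              (lookup-∏M-∉ (λ i → factorTop-supported T (g (suc i))) j j-fresh) ⟩
      coeff (factor T j) oneM ℤ.* coeff (∏P (factor T ∘ g ∘ suc)) (∏M (factorTop T ∘ g ∘ suc))
        ≡⟨ cong₂ ℤ._*_ (coeff-factor-oneM j∈T) (coeff-∏-top (g ∘ suc) (Fin.suc-injective ∘ g-inj)) ⟩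
      ℤ.-1ℤ ∎
      where
      j-fresh : ∀ i → g (suc i) ≢ g zero
      j-fresh i = Fin.0≢1+n ∘ sym ∘ g-inj
    coeff-∏-drop {ℕ.suc k} g g-inj {suc i₀} {j} gi₀≡j j∈T = begin
      coeff (factor T (g zero) *P ∏P (factor T ∘ g ∘ suc)) (dropAt j (g zero) *M ∏M (dropAt j ∘ g ∘ suc))
        ≡⟨ cong (λ u → coeff (factor T (g zero) *P ∏P (factor T ∘ g ∘ suc)) (u *M ∏M (dropAt j ∘ g ∘ suc)))
                (dropAt-≢ j≢g₀) ⟩
      coeff (factor T (g zero) *P ∏P (factor T ∘ g ∘ suc)) (factorTop T (g zero) *M ∏M (dropAt j ∘ g ∘ suc))
        ≡⟨ coeff-*P-separated (g zero) (factor-supported T (g zero)) (∏-off (g ∘ suc) (g zero) g₀-fresh)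
                              (factorTop-supported T (g zero))
                              (lookup-∏M-∉ (λ i → dropAt-supported j (g (suc i))) (g zero) g₀-fresh) ⟩
      coeff (factor T (g zero)) (factorTop T (g zero)) ℤ.* coeff (∏P (factor T ∘ g ∘ suc)) (∏M (dropAt j ∘ g ∘ suc))
        ≡⟨ cong₂ ℤ._*_ (coeff-factor-top T (g zero)) (coeff-∏-drop (g ∘ suc) (Fin.suc-injective ∘ g-inj) gi₀≡j j∈T) ⟩
      ℤ.-1ℤ ∎
      where
      g₀-fresh : ∀ i → g (suc i) ≢ g zero
      g₀-fresh i = Fin.0≢1+n ∘ sym ∘ g-inj
      j≢g₀ : j ≢ g zero
      j≢g₀ j≡g₀ = Fin.0≢1+n (g-inj (trans (sym j≡g₀) (sym gi₀≡j)))

    private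
      lookup-factorTop : ∀ x → lookup (factorTop T x) x ≡ lookup (setM T) x
      lookup-factorTop x with x ∈? T
      ... | yes x∈T = trans (lookup-varM-≡ x) (sym (lookup-setM-∈ x∈T))
      ... | no x∉T = trans (lookup-oneM x) (sym (lookup-setM-∉ x∉T))

      ∏M-factorTop : ∏M (factorTop T) ≡ setM T
      ∏M-factorTop = Mono-ext λ x →
        trans (lookup-∏M-∈ (factorTop-supported T) (λ x≡y → x≡y) refl) (lookup-factorTop x)

      ∏M-dropAt : ∀ j → ∏M (dropAt j) ≡ setM (T - j)
      ∏M-dropAt j = Mono-ext λ x → trans (lookup-∏M-∈ (dropAt-supported j) (λ x≡y → x≡y) refl) (coordinate x)
        where
        coordinate : ∀ x → lookup (dropAt j x) x ≡ lookup (setM (T - j)) x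
        coordinate x with j Fin.≟ x
        ... | yes refl = trans (lookup-oneM j) (sym (lookup-setM-removed {S = T} j))
        ... | no j≢x = trans (lookup-factorTop x) (sym (lookup-setM-remove {S = T} (j≢x ∘ sym)))

    prodMinusOne-bounded : AllTerms (_∣M setM T) (prodMinusOne T)
    prodMinusOne-bounded = subst (λ m → AllTerms (_∣M m) (prodMinusOne T)) ∏M-factorTop (∏-bounded (λ i → i))

    coeff-prodMinusOne-setM : coeff (prodMinusOne T) (setM T) ≡ ℤ.1ℤ
    coeff-prodMinusOne-setM =
      subst (λ m → coeff (prodMinusOne T) m ≡ ℤ.1ℤ) ∏M-factorTop (coeff-∏-top (λ i → i) (λ x≡y → x≡y))

    coeff-prodMinusOne-setM-remove : ∀ {j} → j ∈ T → coeff (prodMinusOne T) (setM (T - j)) ≡ ℤ.-1ℤ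
    coeff-prodMinusOne-setM-remove {j} j∈T =
      subst (λ m → coeff (prodMinusOne T) m ≡ ℤ.-1ℤ) (∏M-dropAt j) (coeff-∏-drop (λ i → i) (λ x≡y → x≡y) refl j∈T)

open import Data.Empty using (⊥; ⊥-elim)
open import Data.Fin using (_<_)
import Data.Fin as Fin
open import Data.Fin.Subset using (Subset; _∈_; _∉_; _⊆_; _∩_; _∪_; _─_; _-_) renaming (⊥ to ∅)
open import Data.Fin.Subset.Properties
  using (_∈?_; ⊆-antisym; x∈p∩q⁺; x∈p∩q⁻; x∈p∪q⁻; x∈p∧x≢y⇒x∈p-y; ∉⊥; p⊆p∪q; q⊆p∪q)
import Data.Nat as ℕ
import Data.Nat.Properties as ℕ
open import Data.Product using (∃; _×_; _,_; proj₁; proj₂)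
open import Data.Sum using (inj₁; inj₂)
open import Data.Vec using (lookup)
open import Function using (_∘_)
open import Relation.Binary.PropositionalEquality using (_≡_; _≢_; refl; sym; trans; cong; cong₂; subst)
open import Relation.Nullary using (¬_; yes; no)
open import Relation.Nullary.Decidable using (decidable-stable)

module InitialTerms {n : ℕ} (ord : MonomialOrder n)
  (var-order : ∀ i j → i < j → MonomialOrder._≺_ ord (varM i) (varM j)) where

  open import Defs using (oneM; _*M_; _∣M_; setM; Poly; coeff; IsInitial; oneP; varP; setP; -P_; _-P_; _*P_; prodMinusOne)
  open MonomialOrder ord
  open Monomials
  open Polynomials
  open Binomials
  open Subsets
  open import Data.Empty using (⊥-elim)
  open import Data.Fin as Fin using (suc) renaming (_≤_ to _≤ꟳ_)
  import Data.Fin.Properties as Fin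
  open import Data.Fin.Subset using (Subset; _∈_; _∉_; _∪_; _-_)
  open import Data.Fin.Subset.Properties using (_∈?_; p─x─y≡p─y─x; x∈p∧x≢y⇒x∈p-y; x∈p∪q⁻; ∪-comm)
  open import Data.Integer as ℤ using (ℤ)
  import Data.Integer.Properties as ℤ
  open import Data.List using ([]; _∷_)
  open import Data.List.Relation.Unary.All using ([]; _∷_)
  import Data.List.Relation.Unary.All.Properties as All
  import Data.Nat as ℕ
  import Data.Nat.Properties as ℕ
  open import Data.Product using (_,_; proj₁)
  open import Data.Sum using (_⊎_; inj₁; inj₂)
  open import Data.Vec using (lookup)
  open import Data.Vec.Properties using (≡-dec)
  open import Function using (_∘_)
  open import Relation.Binary.PropositionalEquality
  open import Relation.Binary.Structures using (IsStrictTotalOrder)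
  open import Relation.Nullary using (yes; no)
  open ≡-Reasoning

  private
    1ℤ≢0ℤ : ℤ.1ℤ ≢ ℤ.0ℤ
    1ℤ≢0ℤ ()

  infix 4 _≼_

  _≼_ : Mono n → Mono n → Set
  a ≼ b = a ≡ b ⊎ a ≺ b

  ≼-trans : ∀ {a b c} → a ≼ b → b ≼ c → a ≼ c
  ≼-trans (inj₁ refl) b≼c = b≼c
  ≼-trans (inj₂ a≺b) (inj₁ refl) = inj₂ a≺b
  ≼-trans (inj₂ a≺b) (inj₂ b≺c) = inj₂ (IsStrictTotalOrder.trans isStrictTotalOrder a≺b b≺c)

  ∣M⇒≼ : ∀ {a b} → a ∣M b → a ≼ b
  ∣M⇒≼ {a} {b} a∣b with ∣M⇒*M a∣b
  ... | c , ac≡b with ≡-dec ℕ._≟_ c oneM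
  ...   | yes refl = inj₁ (trans (sym (*M-identityʳ a)) ac≡b)
  ...   | no c≢1 = inj₂ (subst₂ _≺_ (*M-identityˡ a) (trans (*M-comm c a) ac≡b) (mult oneM c a (one-least c c≢1)))

  initial-of-bound : ∀ (f : Poly n) a → coeff f a ≢ ℤ.0ℤ → AllTerms (_∣M a) f → IsInitial ord f a
  initial-of-bound f a fa≢0 bounded = fa≢0 , λ z fz≢0 → ∣M⇒≼ (coeff≢0⇒ {P = _∣M a} z bounded fz≢0)

  setM-remove-≺ : ∀ {S : Subset n} {k i} → k < i → k ∈ S → i ∈ S → setM (S - i) ≺ setM (S - k)
  setM-remove-≺ {S} {k} {i} k<i k∈S i∈S =
    subst₂ _≺_ (trans (*M-comm (varM k) R) (setM-*M-varM k∈S-i))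
               (trans (*M-comm (varM i) R) (trans (cong (λ T → setM T *M varM i) (p─x─y≡p─y─x S i k)) (setM-*M-varM i∈S-k)))
               (mult (varM k) (varM i) R (var-order k i k<i))
    where
    R = setM (S - i - k)
    k≢i : k ≢ i
    k≢i = Fin.<⇒≢ k<i
    k∈S-i : k ∈ S - i
    k∈S-i = x∈p∧x≢y⇒x∈p-y k∈S k≢i
    i∈S-k : i ∈ S - k
    i∈S-k = x∈p∧x≢y⇒x∈p-y i∈S (k≢i ∘ sym)

  initial-idem : ∀ i → IsInitial ord ((varP i *P varP i) -P varP i) (varM i *M varM i)
  initial-idem i = initial-of-bound ((varP i *P varP i) -P varP i) (varM i *M varM i) coeff≢0
                                    (∣M-refl (varM i *M varM i) ∷ ∣M⁺ varM≤varM² ∷ [])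
    where
    varM≤varM² : ∀ x → lookup (varM i) x ℕ.≤ lookup (varM i *M varM i) x
    varM≤varM² x = subst (lookup (varM i) x ℕ.≤_) (sym (lookup-*M (varM i) (varM i) x)) (ℕ.m≤m+n _ _)
    varM≢varM² : varM i ≢ varM i *M varM i
    varM≢varM² e = ℕ.1+n≢n {1} (sym (begin
      1                                   ≡⟨ sym (lookup-varM-≡ i) ⟩
      lookup (varM i) i                   ≡⟨ cong (λ m → lookup m i) e ⟩
      lookup (varM i *M varM i) i         ≡⟨ lookup-*M (varM i) (varM i) i ⟩
      lookup (varM i) i ℕ.+ lookup (varM i) i ≡⟨ cong₂ ℕ._+_ (lookup-varM-≡ i) (lookup-varM-≡ i) ⟩
      2                                   ∎))
    coeff≢0 : coeff ((varP i *P varP i) -P varP i) (varM i *M varM i) ≢ ℤ.0ℤ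
    coeff≢0 c≡0 = 1ℤ≢0ℤ (trans (sym (trans (coeff-∷-≡ (ℤ.1ℤ ℤ.* ℤ.1ℤ) (varM i *M varM i) ((ℤ.- ℤ.1ℤ , varM i) ∷ []))
                                                (cong (λ z → ℤ.1ℤ ℤ.+ z) (coeff-∷-≢ (ℤ.- ℤ.1ℤ) [] varM≢varM²)))) c≡0)

  initial-inW : ∀ i → IsInitial ord (varP i -P oneP) (varM i)
  initial-inW i = initial-of-bound (varP i -P oneP) (varM i) coeff≢0 (∣M-refl (varM i) ∷ oneM-∣M (varM i) ∷ [])
    where
    coeff≢0 : coeff (varP i -P oneP) (varM i) ≢ ℤ.0ℤ
    coeff≢0 c≡0 = 1ℤ≢0ℤ (trans (sym (trans (coeff-∷-≡ ℤ.1ℤ (varM i) ((ℤ.- ℤ.1ℤ , oneM) ∷ []))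
                                                (cong (λ z → ℤ.1ℤ ℤ.+ z) (coeff-∷-≢ (ℤ.- ℤ.1ℤ) [] (oneM≢varM i))))) c≡0)

  coeff-setP-*P : ∀ (A : Subset n) {Q} {q : Poly n} v → AllTerms Q q → coeff (setP A *P q) (setM A *M v) ≡ coeff q v
  coeff-setP-*P A {q = q} v Qq = begin
    coeff (setP A *P q) (setM A *M v)
      ≡⟨ coeff-*P {P = _≡ setM A} {p = setP A} (setM A) v (refl ∷ []) Qq (λ a _ a≡A _ _ → a≡A) ⟩
    coeff (setP A) (setM A) ℤ.* coeff q v      ≡⟨ cong (ℤ._* coeff q v) (coeff-∷-≡ ℤ.1ℤ (setM A) []) ⟩
    ℤ.1ℤ ℤ.* coeff q v                         ≡⟨ ℤ.*-identityˡ (coeff q v) ⟩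
    coeff q v                                  ∎

  coeff-setP-*P-absent : ∀ {A : Subset n} {Q} {q : Poly n} z {m} → m ∈ A → lookup z m ≡ 0 → AllTerms Q q →
                         coeff (setP A *P q) z ≡ ℤ.0ℤ
  coeff-setP-*P-absent {A} {q = q} z {m} m∈A zm≡0 Qq =
    coeff-absent z (AllTerms-*P {P = _≡ setM A} {p = setP A} {q = q}
                     (λ { a b refl _ Ab≡z → ℕ.0≢1+n (trans (sym zm≡0) (m-coordinate b Ab≡z)) }) (refl ∷ []) Qq)
    where
    m-coordinate : ∀ b → setM A *M b ≡ z → lookup z m ≡ ℕ.suc (lookup b m)
    m-coordinate b Ab≡z = trans (cong (λ x → lookup x m) (sym Ab≡z))
                                (trans (lookup-*M (setM A) b m) (cong (ℕ._+ lookup b m) (lookup-setM-∈ m∈A)))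

  binomial-bounded : ∀ (A B : Subset n) → AllTerms (_∣M (setM A *M setM B)) (setP A *P prodMinusOne B)
  binomial-bounded A B =
    AllTerms-*P {p = setP A} {q = prodMinusOne B} (λ _ _ → *M-mono-∣M) (∣M-refl (setM A) ∷ []) (prodMinusOne-bounded B)

  coeff-binomial-top : ∀ (A B : Subset n) → coeff (setP A *P prodMinusOne B) (setM A *M setM B) ≡ ℤ.1ℤ
  coeff-binomial-top A B = trans (coeff-setP-*P A {q = prodMinusOne B} (setM B) (prodMinusOne-bounded B)) (coeff-prodMinusOne-setM B)

  initial-binomial : ∀ (A B : Subset n) → IsInitial ord (setP A *P prodMinusOne B) (setM A *M setM B)
  initial-binomial A B = initial-of-bound (setP A *P prodMinusOne B) (setM A *M setM B)
    (λ c≡0 → 1ℤ≢0ℤ (trans (sym (coeff-binomial-top A B)) c≡0)) (binomial-bounded A B)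

  coeff-binomial-removed : ∀ {U V : Subset n} {m} → (∀ {x} → x ∈ U → x ∉ V) → m ∈ V →
                           coeff (setP U *P prodMinusOne V) (setM ((U ∪ V) - m)) ≡ ℤ.-1ℤ
  coeff-binomial-removed {U} {V} {m} U∩V≡∅ m∈V = begin
    coeff (setP U *P prodMinusOne V) (setM ((U ∪ V) - m))   ≡⟨ cong (λ S → coeff (setP U *P prodMinusOne V) (setM S)) (∪-remove m∉U) ⟩
    coeff (setP U *P prodMinusOne V) (setM (U ∪ (V - m)))   ≡⟨ cong (coeff (setP U *P prodMinusOne V)) (setM-∪ U∩V-m≡∅) ⟩
    coeff (setP U *P prodMinusOne V) (setM U *M setM (V - m)) ≡⟨ coeff-setP-*P U {q = prodMinusOne V} (setM (V - m)) (prodMinusOne-bounded V) ⟩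
    coeff (prodMinusOne V) (setM (V - m))                    ≡⟨ coeff-prodMinusOne-setM-remove V m∈V ⟩
    ℤ.-1ℤ                                                    ∎
    where
    m∉U : m ∉ U
    m∉U m∈U = U∩V≡∅ m∈U m∈V
    U∩V-m≡∅ : ∀ {x} → x ∈ U → x ∉ V - m
    U∩V-m≡∅ x∈U = U∩V≡∅ x∈U ∘ proj₁ ∘ x∈p-y⁻

  removal-≼-min : ∀ {C : Subset n} {m x} → (∀ j → j ∈ C → m ≤ꟳ j) → m ∈ C → x ∈ C → setM (C - x) ≼ setM (C - m)
  removal-≼-min {m = m} {x} m-min m∈C x∈C with m Fin.≟ x
  ... | yes refl = inj₁ refl
  ... | no m≢x = inj₂ (setM-remove-≺ (Fin.≤∧≢⇒< (m-min x x∈C) m≢x) m∈C x∈C)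

  -- The two leading terms e_C of the generator cancel; what remains is led by e_(C - min C).
  initial-circ⁰ : ∀ {X Y : Subset n} {m} → (∀ {x} → x ∈ X → x ∉ Y) →
                  m ∈ X ∪ Y → (∀ j → j ∈ X ∪ Y → m ≤ꟳ j) →
                  IsInitial ord ((setP X *P prodMinusOne Y) -P (setP Y *P prodMinusOne X)) (setM ((X ∪ Y) - m))
  initial-circ⁰ {X} {Y} {m} X∩Y≡∅ m∈C m-min = coeff-removed≢0 , dominated
    where
    C = X ∪ Y
    P₁ = setP X *P prodMinusOne Y
    P₂ = setP Y *P prodMinusOne X
    Y∩X≡∅ : ∀ {x} → x ∈ Y → x ∉ X
    Y∩X≡∅ x∈Y x∈X = X∩Y≡∅ x∈X x∈Y
    coeff-difference : ∀ z → coeff (P₁ -P P₂) z ≡ coeff P₁ z ℤ.- coeff P₂ z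
    coeff-difference z = trans (coeff-++ P₁ (-P P₂) z) (cong (λ c → coeff P₁ z ℤ.+ c) (coeff--P P₂ z))
    setM-C : setM C ≡ setM X *M setM Y
    setM-C = setM-∪ X∩Y≡∅
    setM-C′ : setM C ≡ setM Y *M setM X
    setM-C′ = trans setM-C (*M-comm (setM X) (setM Y))
    bounded : AllTerms (_∣M setM C) (P₁ -P P₂)
    bounded = All.++⁺ (subst (λ t → AllTerms (_∣M t) P₁) (sym setM-C) (binomial-bounded X Y))
                      (AllTerms--P (subst (λ t → AllTerms (_∣M t) P₂) (sym setM-C′) (binomial-bounded Y X)))
    coeff-C : coeff (P₁ -P P₂) (setM C) ≡ ℤ.0ℤ
    coeff-C = begin
      coeff (P₁ -P P₂) (setM C)                 ≡⟨ coeff-difference (setM C) ⟩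
      coeff P₁ (setM C) ℤ.- coeff P₂ (setM C)   ≡⟨ cong₂ ℤ._-_ (trans (cong (coeff P₁) setM-C) (coeff-binomial-top X Y))
                                                               (trans (cong (coeff P₂) setM-C′) (coeff-binomial-top Y X)) ⟩
      ℤ.1ℤ ℤ.- ℤ.1ℤ                             ≡⟨⟩
      ℤ.0ℤ                                      ∎
    coeff-removed≢0 : coeff (P₁ -P P₂) (setM (C - m)) ≢ ℤ.0ℤ
    coeff-removed≢0 with m ∈? X
    ... | yes m∈X = λ c≡0 → 1ℤ≢0ℤ (trans (sym (begin
      coeff (P₁ -P P₂) (setM (C - m))                       ≡⟨ coeff-difference (setM (C - m)) ⟩
      coeff P₁ (setM (C - m)) ℤ.- coeff P₂ (setM (C - m))
        ≡⟨ cong₂ ℤ._-_ (coeff-setP-*P-absent {q = prodMinusOne Y} (setM (C - m)) m∈X (lookup-setM-removed {S = C} m)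
                                             (prodMinusOne-bounded Y))
                       (trans (cong (λ S → coeff P₂ (setM (S - m))) (∪-comm X Y)) (coeff-binomial-removed Y∩X≡∅ m∈X)) ⟩
      ℤ.0ℤ ℤ.- ℤ.-1ℤ                                        ≡⟨⟩
      ℤ.1ℤ                                                  ∎)) c≡0)
    ... | no m∉X = λ c≡0 → -1ℤ≢0ℤ (trans (sym (begin
      coeff (P₁ -P P₂) (setM (C - m))                       ≡⟨ coeff-difference (setM (C - m)) ⟩
      coeff P₁ (setM (C - m)) ℤ.- coeff P₂ (setM (C - m))
        ≡⟨ cong₂ ℤ._-_ (coeff-binomial-removed X∩Y≡∅ m∈Y)
                       (coeff-setP-*P-absent {q = prodMinusOne X} (setM (C - m)) m∈Y (lookup-setM-removed {S = C} m)
                                             (prodMinusOne-bounded X)) ⟩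
      ℤ.-1ℤ ℤ.- ℤ.0ℤ                                        ≡⟨⟩
      ℤ.-1ℤ                                                 ∎)) c≡0)
      where
      m∈Y : m ∈ Y
      m∈Y with x∈p∪q⁻ X Y m∈C
      ... | inj₁ m∈X = ⊥-elim (m∉X m∈X)
      ... | inj₂ m∈Y = m∈Y
      -1ℤ≢0ℤ : ℤ.-1ℤ ≢ ℤ.0ℤ
      -1ℤ≢0ℤ ()
    dominated : ∀ z → coeff (P₁ -P P₂) z ≢ ℤ.0ℤ → z ≼ setM (C - m)
    dominated z cz≢0 =
      let (x , x∈C , z∣C-x) = proper-∣M-setM (coeff≢0⇒ {P = _∣M setM C} z bounded cz≢0) (λ { refl → cz≢0 coeff-C })
      in ≼-trans (∣M⇒≼ z∣C-x) (removal-≼-min m-min m∈C x∈C)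

open Subsets
open Monomials

module _ (ℝ : RealField) {ℓ n} (v : Fin n → Point ℝ ℓ) (W : Subset n) where
  open RealField ℝ hiding (_<_)
  open OrderedField ℝ
  open LinearAlgebra ℝ
  open Motzkin ℝ using (System; Certificate; motzkin)
  open Circuits ℝ v using (PositiveCircuit; PositiveDependency; signedCircuit-disjoint;
                           no-positiveCircuit⇒no-positiveDependency)

  coneSystem : Subset n → System ℓ n n
  coneSystem N = record { eq = v ; eq? = lookup N ; ineq = v ; ineq? = lookup W }

  certificate⇒positiveDependency : ∀ {N} → (∀ {i} → i ∈ W → i ∉ N) → Certificate (coneSystem N) →
                                   ∃ (PositiveDependency W N)
  certificate⇒positiveDependency {N} W∩N≡∅ (λᵉ , λⁱ , dep , offᵉ , offⁱ , λⁱ≥0 , (j , 0<λⁱj)) = μ , record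
    { dependency = λ t → trans (∑-cong (λ i → distribʳ (v i t) (λᵉ i) (λⁱ i)))
                               (trans (∑-distrib-+ (λ i → λᵉ i * v i t) (λ i → λⁱ i * v i t)) (dep t))
    ; outside    = λ i i∉N i∉W → trans (cong₂ _+_ (offᵉ i (∉⇒lookup i∉N)) (offⁱ i (∉⇒lookup i∉W))) (+-identityˡ 0#)
    ; nonNeg     = λ i i∈W → subst (0# ≤ᵣ_) (sym (μ|W i∈W)) (λⁱ≥0 i)
    ; witness    = j
    ; witness∈W  = j∈W
    ; witness>0  = subst (RealField._<_ ℝ 0#) (sym (μ|W j∈W)) 0<λⁱj
    }
    where
    μ = λ i → λᵉ i + λⁱ i
    μ|W : ∀ {i} → i ∈ W → μ i ≡ λⁱ i
    μ|W i∈W = trans (cong (_+ _) (offᵉ _ (∉⇒lookup (W∩N≡∅ i∈W)))) (+-identityˡ _)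
    j∈W : j ∈ W
    j∈W = decidable-stable (j ∈? W) (λ j∉W → >⇒≢ 0<λⁱj (offⁱ j (∉⇒lookup j∉W)))

  module _ (ord : MonomialOrder n) (var-order : ∀ i j → i < j → MonomialOrder._≺_ ord (varM i) (varM j)) where
    open InitialTerms ord var-order

    module _ {m : Mono n} (std : IsStandard ℝ v W ord m) where

      standard-exponent-≤1 : ∀ i → lookup m i ℕ.≤ 1
      standard-exponent-≤1 i with lookup m i ℕ.≤? 1
      ... | yes mi≤1 = mi≤1
      ... | no mi≰1 = ⊥-elim (std _ (InG.idem i) _ (initial-idem i) (varM²-∣M i (ℕ.≰⇒> mi≰1)))

      standard-W-free : ∀ i → i ∈ W → lookup m i ≡ 0
      standard-W-free i i∈W with lookup m i ℕ.≟ 0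
      ... | yes mi≡0 = mi≡0
      ... | no mi≢0 = ⊥-elim (std _ (InG.inW i i∈W) _ (initial-inW i) (varM-∣M i (ℕ.n≢0⇒n>0 mi≢0)))

      exponentSupport : Subset n
      exponentSupport = decSubset (λ i → 1 ℕ.≤? lookup m i)

      standard-squarefree : m ≡ setM exponentSupport
      standard-squarefree = Mono-ext coordinate
        where
        coordinate : ∀ i → lookup m i ≡ lookup (setM exponentSupport) i
        coordinate i with 1 ℕ.≤? lookup m i
        ... | yes 1≤mi = trans (ℕ.≤-antisym (standard-exponent-≤1 i) 1≤mi)
                               (sym (lookup-setM-∈ (∈-decSubset⁺ (λ i → 1 ℕ.≤? lookup m i) 1≤mi)))
        ... | no 1≰mi = trans (ℕ.n<1⇒n≡0 (ℕ.≰⇒> 1≰mi))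
                              (sym (lookup-setM-∉ (1≰mi ∘ ∈-decSubset⁻ (λ i → 1 ℕ.≤? lookup m i))))

      exponentSupport-W-disjoint : ∀ {i} → i ∈ W → i ∉ exponentSupport
      exponentSupport-W-disjoint {i} i∈W i∈N =
        ℕ.n≮0 (subst (1 ℕ.≤_) (standard-W-free i i∈W) (∈-decSubset⁻ (λ i → 1 ℕ.≤? lookup m i) i∈N))

    module _ {N : Subset n} (std : IsStandard ℝ v W ord (setM N)) (W∩N≡∅ : ∀ {i} → i ∈ W → i ∉ N) where

      binomial-excluded : ∀ {A B} → InG ℝ v W (setP A *P prodMinusOne B) → (∀ {x} → x ∈ A → x ∉ B) →
                          A ⊆ N → B ⊆ N → ⊥
      binomial-excluded {A} {B} g A∩B≡∅ A⊆N B⊆N =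
        std _ g _ (initial-binomial A B) (subst (_∣M setM N) (setM-∪ A∩B≡∅) (setM-mono A∪B⊆N))
        where
        A∪B⊆N : A ∪ B ⊆ N
        A∪B⊆N x∈ with x∈p∪q⁻ A B x∈
        ... | inj₁ x∈A = A⊆N x∈A
        ... | inj₂ x∈B = B⊆N x∈B

      positiveCircuit-excluded : ∀ {C⁺ C⁻} → ¬ PositiveCircuit W N C⁺ C⁻
      positiveCircuit-excluded P =
        binomial-excluded (InG.circ⁺ _ _ circuit meets-W W-positive)
                          (signedCircuit-disjoint circuit ∘ proj₁ ∘ x∈p─q⁻)
                          (λ x∈ → let (x∈C⁺ , x∉W) = x∈p─q⁻ x∈ in positive⊆ _ x∈C⁺ x∉W)
                          negative⊆
        where open PositiveCircuit P

      module _ {C⁺ C⁻ : Subset n} {m} (C-m⊆N : (C⁺ ∪ C⁻) - m ⊆ N) where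
        private
          C = C⁺ ∪ C⁻

        in-N : ∀ {x} → x ∈ C → x ≢ m → x ∈ N
        in-N x∈C x≢m = C-m⊆N (x∈p∧x≢y⇒x∈p-y x∈C x≢m)

        off-W : ∀ {x} → x ∈ C → x ≢ m → x ∉ W
        off-W x∈C x≢m x∈W = W∩N≡∅ x∈W (in-N x∈C x≢m)

        W∩part≡W∩C : ∀ {D} → D ⊆ C → m ∈ D → W ∩ D ≡ W ∩ C
        W∩part≡W∩C {D} D⊆C m∈D = ⊆-antisym
          (λ x∈ → let (x∈W , x∈D) = x∈p∩q⁻ W D x∈ in x∈p∩q⁺ (x∈W , D⊆C x∈D))
          (λ {x} x∈ → let (x∈W , x∈C) = x∈p∩q⁻ W C x∈ in
                      x∈p∩q⁺ (x∈W , subst (_∈ D) (sym (decidable-stable (x Fin.≟ m) (λ x≢m → off-W x∈C x≢m x∈W))) m∈D))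

        part─W⊆N : ∀ {D} → m ∈ W → D ⊆ C → D ─ W ⊆ N
        part─W⊆N m∈W D⊆C x∈ = let (x∈D , x∉W) = x∈p─q⁻ x∈ in in-N (D⊆C x∈D) (λ { refl → x∉W m∈W })

        other⊆N : ∀ {E} → E ⊆ C → m ∉ E → E ⊆ N
        other⊆N E⊆C m∉E x∈E = in-N (E⊆C x∈E) (λ { refl → m∉E x∈E })

        W∩C≡∅ : m ∉ W → W ∩ C ≡ ∅
        W∩C≡∅ m∉W = ⊆-antisym (λ {x} x∈ → let (x∈W , x∈C) = x∈p∩q⁻ W C x∈ in
                                           ⊥-elim (off-W x∈C (λ { refl → m∉W x∈W }) x∈W))
                              (⊥-elim ∘ ∉⊥)

      no-broken-circuit : ∀ B → BrokenCircuit ℝ v B → ¬ (B ⊆ N)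
      no-broken-circuit _ (C⁺ , C⁻ , m , circuit , m∈C , m-min , refl) C-m⊆N with m ∈? W
      ... | no m∉W = std _ (InG.circ⁰ C⁺ C⁻ circuit (W∩C≡∅ C-m⊆N m∉W)) _
                           (initial-circ⁰ (signedCircuit-disjoint circuit) m∈C m-min) (setM-mono C-m⊆N)
      ... | yes m∈W with x∈p∪q⁻ C⁺ C⁻ m∈C
      ...   | inj₁ m∈C⁺ =
        binomial-excluded (InG.circ⁺ C⁺ C⁻ circuit (m , x∈p∩q⁺ (m∈W , m∈C⁺))
                                     (W∩part≡W∩C C-m⊆N (p⊆p∪q C⁻) m∈C⁺))
                          (signedCircuit-disjoint circuit ∘ proj₁ ∘ x∈p─q⁻)
                          (part─W⊆N C-m⊆N m∈W (p⊆p∪q C⁻))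
                          (other⊆N C-m⊆N (q⊆p∪q C⁺ C⁻) (signedCircuit-disjoint circuit m∈C⁺))
      ...   | inj₂ m∈C⁻ =
        binomial-excluded (InG.circ⁻ C⁺ C⁻ circuit (m , x∈p∩q⁺ (m∈W , m∈C⁻))
                                     (W∩part≡W∩C C-m⊆N (q⊆p∪q C⁺ C⁻) m∈C⁻))
                          (λ x∈ x∈C⁺ → signedCircuit-disjoint circuit x∈C⁺ (proj₁ (x∈p─q⁻ x∈)))
                          (part─W⊆N C-m⊆N m∈W (q⊆p∪q C⁺ C⁻))
                          (other⊆N C-m⊆N (p⊆p∪q C⁻) (λ m∈C⁺ → signedCircuit-disjoint circuit m∈C⁺ m∈C⁻))

      cone-meets-flat : ∃ λ x → (∀ i → i ∈ N → v i ∙ x ≡ 0#) × InCone ℝ v W x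
      cone-meets-flat with motzkin n n (coneSystem N)
      ... | inj₁ (x , eqs , ineqs) = x , (λ i → eqs i ∘ ∈⇒lookup) , (λ i → ineqs i ∘ ∈⇒lookup)
      ... | inj₂ certificate = ⊥-elim (no-positiveCircuit⇒no-positiveDependency W N (λ _ _ → positiveCircuit-excluded) _
                                         (proj₂ (certificate⇒positiveDependency W∩N≡∅ certificate)))

proposition3p2 : (ℝ : RealField) → (ℓ n : ℕ) → (v : Fin n → Point ℝ ℓ) → IsArrangement ℝ v →
    (W : Subset n) → (∃ λ x → InCone ℝ v W x) →
    (ord : MonomialOrder n) → (∀ i j → i < j → MonomialOrder._≺_ ord (varM i) (varM j)) →
    (m : Mono n) → IsStandard ℝ v W ord m →
    ∃ λ (N : Subset n) → m ≡ setM N × IsKNBC ℝ v W N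
proposition3p2 ℝ ℓ n v _ W _ ord var-order m std =
  N , m≡e_N , no-broken-circuit ℝ v W ord var-order std′ W∩N≡∅ , cone-meets-flat ℝ v W ord var-order std′ W∩N≡∅
  where
  N = exponentSupport ℝ v W ord var-order std
  m≡e_N : m ≡ setM N
  m≡e_N = standard-squarefree ℝ v W ord var-order std
  std′ : IsStandard ℝ v W ord (setM N)
  std′ = subst (IsStandard ℝ v W ord) m≡e_N std
  W∩N≡∅ : ∀ {i} → i ∈ W → i ∉ N
  W∩N≡∅ = exponentSupport-W-disjoint ℝ v W ord var-order std
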